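{- The set $CSC$ of all indices of CSC spaces is $\Pi^0_2$-complete.
   Context: $(\Phi_e)_{e\in\omega}$ is a standard enumeration of the partial computable functions and $\langle\cdot,\cdot\rangle$ a computable pairing function. A CSC (countable second-countable) space consists of a set of points coded by natural numbers, a sequence $\mathcal U=(U_i)_{i\in\omega}$ of sets of points, and a function $k$ such that every point lies in some $U_i$ and whenever $x\in U_i\cap U_j$ we have $x\in U_{k(i,j,x)}\subseteq U_i\cap U_j$. An index for a CSC space is a pair $\langle m,n\rangle$ such that $\Phi_m$ is total and for all $i,x\in\omega$, $\Phi_m(i,x)=1$ iff $x\in U_i$ and $\Phi_m(i,x)=0$ iff $x\notin U_i$; and $\Phi_n$ is total and for all $i,j,x$ with $x\in U_i\cap U_j$, $\Phi_m(\Phi_n(i,j,x),x)=1$ and every $y$ with $\Phi_m(\Phi_n(i,j,x),y)=1$ satisfies $\Phi_m(i,y)=\Phi_m(j,y)=1$. -}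

module Defs where

-- A self-contained model of the partial computable functions and a standard
-- (total, Goedel) enumeration Phi_e of them, given by a big-step evaluation
-- relation  Eval e x y  meaning  Phi_e(x) converges with value y.

open import Data.Nat using (ℕ; zero; suc; _+_; _*_; _<_)
open import Data.Product using (Σ; ∃; _×_; _,_)
open import Data.Sum using (_⊎_)
open import Function.Bundles using (_⇔_)
open import Relation.Binary.PropositionalEquality using (_≡_)

triangle : ℕ → ℕ
triangle zero    = zero
triangle (suc n) = suc n + triangle n

⟪_,_⟫ : ℕ → ℕ → ℕ
⟪ a , b ⟫ = triangle (a + b) + b

-- Every e ∈ ℕ is uniquely  t + 8 * k  with t < 8, and
-- (for binary constructors) k = ⟪ a , b ⟫ uniquely.  Unary functions;
-- several arguments are coded with ⟪_,_⟫.
--   t = 0 : constant zero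
--   t = 1 : successor
--   t = 2 : first projection of the pairing
--   t = 3 : second projection of the pairing
--   t = 4 : k = ⟪ a , b ⟫ : composition  Phi_a ∘ Phi_b
--   t = 5 : k = ⟪ a , b ⟫ : x ↦ ⟪ Phi_a x , Phi_b x ⟫
--   t = 6 : k = ⟪ a , b ⟫ : primitive recursion
--              h ⟪ x , 0 ⟫ = Phi_a x
--              h ⟪ x , n+1 ⟫ = Phi_b ⟪ x , ⟪ n , h ⟪ x , n ⟫ ⟫ ⟫
--   t = 7 : k = a : minimisation  x ↦ μ n. Phi_a ⟪ x , n ⟫ = 0

data Eval : ℕ → ℕ → ℕ → Set where
  ev-zero : ∀ {e k x} → e ≡ 0 + 8 * k → Eval e x 0
  ev-succ : ∀ {e k x} → e ≡ 1 + 8 * k → Eval e x (suc x)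
  ev-fst  : ∀ {e k x a b} → e ≡ 2 + 8 * k → x ≡ ⟪ a , b ⟫ → Eval e x a
  ev-snd  : ∀ {e k x a b} → e ≡ 3 + 8 * k → x ≡ ⟪ a , b ⟫ → Eval e x b
  ev-comp : ∀ {e a b x z y} → e ≡ 4 + 8 * ⟪ a , b ⟫ →
            Eval b x z → Eval a z y → Eval e x y
  ev-pair : ∀ {e a b x y z} → e ≡ 5 + 8 * ⟪ a , b ⟫ →
            Eval a x y → Eval b x z → Eval e x ⟪ y , z ⟫
  ev-rec0 : ∀ {e a b x y} → e ≡ 6 + 8 * ⟪ a , b ⟫ →
            Eval a x y → Eval e ⟪ x , 0 ⟫ y
  ev-recS : ∀ {e a b x n z y} → e ≡ 6 + 8 * ⟪ a , b ⟫ →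
            Eval e ⟪ x , n ⟫ z → Eval b ⟪ x , ⟪ n , z ⟫ ⟫ y →
            Eval e ⟪ x , suc n ⟫ y
  ev-mu   : ∀ {e a x n} → e ≡ 7 + 8 * a →
            Eval a ⟪ x , n ⟫ 0 →
            (∀ m → m < n → Σ ℕ (λ v → Eval a ⟪ x , m ⟫ (suc v))) →
            Eval e x n

Total : ℕ → Set
Total e = ∀ x → Σ ℕ (λ y → Eval e x y)

-- Index of a CSC space (as in the paper), with
--   Phi_m(i,x) := Phi_m(⟪ i , x ⟫),  Phi_n(i,j,x) := Phi_n(⟪ i , ⟪ j , x ⟫ ⟫).

IsCSCIndex : ℕ → Set
IsCSCIndex c =
  Σ ℕ λ m → Σ ℕ λ n →
    c ≡ ⟪ m , n ⟫ ×
    Total m ×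
    (∀ i x → Eval m ⟪ i , x ⟫ 0 ⊎ Eval m ⟪ i , x ⟫ 1) ×
    Total n ×
    (∀ i j x → Eval m ⟪ i , x ⟫ 1 → Eval m ⟪ j , x ⟫ 1 →
       ∀ k → Eval n ⟪ i , ⟪ j , x ⟫ ⟫ k →
         Eval m ⟪ k , x ⟫ 1 ×
         (∀ y → Eval m ⟪ k , y ⟫ 1 → Eval m ⟪ i , y ⟫ 1 × Eval m ⟪ j , y ⟫ 1))

-- P is Π⁰₂: P x ⇔ ∀ y ∃ z R(x,y,z), R computable, i.e. R decided by a
-- total Phi_e, R(x,y,z) iff Phi_e(⟪ x , ⟪ y , z ⟫ ⟫) = 0.
IsΠ⁰₂ : (ℕ → Set) → Set
IsΠ⁰₂ P = Σ ℕ λ e → Total e ×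
  (∀ x → P x ⇔ (∀ y → Σ ℕ λ z → Eval e ⟪ x , ⟪ y , z ⟫ ⟫ 0))

_≤ₘ_ : (ℕ → Set) → (ℕ → Set) → Set
Q ≤ₘ P = Σ ℕ λ f → Total f × (∀ x y → Eval f x y → (Q x ⇔ P y))

IsΠ⁰₂-complete : (ℕ → Set) → Set₁
IsΠ⁰₂-complete P = IsΠ⁰₂ P × (∀ (Q : ℕ → Set) → IsΠ⁰₂ Q → Q ≤ₘ P)

-- Upper bound.  Φ_e(x) = v holds exactly when a stack machine for the Gödel numbering, started
-- on e and x, halts with v after finitely many steps, and a single step of this machine is a
-- total computable function on encoded states.  So ⟪ m , n ⟫ is a CSC index iff for all i, j, x, y
-- there is a step bound z within which the seven computations Φ_m⟪i,x⟫, Φ_m⟪j,x⟫,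
-- k = Φ_n⟪i,⟪j,x⟫⟫, Φ_m⟪k,x⟫, Φ_m⟪k,y⟫, Φ_m⟪i,y⟫, Φ_m⟪j,y⟫ all halt with values satisfying the
-- axioms at i, j, x, y: a decidable condition of (c, ⟪ i , ⟪ j , ⟪ x , y ⟫ ⟫ ⟫, z).
--
-- Lower bound.  If Q(x) ⇔ ∀u ∃z R(x,u,z) with R decidable, let M_x compute 1 on u after searching
-- for the least z with R(x,u,z).  Every U_i of ⟪ M_x , code of λ_ → 0 ⟫ is then all of ℕ, so it
-- is a CSC index iff M_x is total, i.e. iff Q(x); and x ↦ M_x is computable by the s-m-n theorem.

module Submission where

open import Defs
open import Data.List using (List; []; _∷_)
open import Data.List.Relation.Unary.All using (All; []; _∷_)
open import Data.Nat using (ℕ; zero; suc; _+_; _*_; _<_; _≤_; z≤n; s≤s; z<s; pred; _∸_)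
open import Data.Nat.DivMod using (_/_; _%_; m≡m%n+[m/n]*n; m%n<n)
open import Data.Nat.GeneralisedArithmetic using (fold; fold-+; *+-is-fold)
open import Data.Nat.Induction using (<-wellFounded)
open import Data.Nat.Properties
open import Data.Product using (∃; _×_; _,_; proj₁; proj₂)
open import Data.Sum using (_⊎_; inj₁; inj₂)
open import Function.Base using (id; _∘_; case_of_)
open import Function.Bundles using (_⇔_; mk⇔; Equivalence)
open import Function.Construct.Composition using (_⇔-∘_)
open import Function.Construct.Symmetry using (⇔-sym)
open import Induction.WellFounded using (Acc; acc)
open import Relation.Binary.PropositionalEquality
open import Relation.Nullary using (contradiction)

⟪,⟫-sucʳ : ∀ a b → ⟪ a , suc b ⟫ ≡ suc ⟪ suc a , b ⟫
⟪,⟫-sucʳ a b rewrite +-suc a b | +-suc (triangle (suc (a + b))) b = refl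

⟪suc,0⟫ : ∀ a → ⟪ suc a , 0 ⟫ ≡ suc ⟪ 0 , a ⟫
⟪suc,0⟫ a rewrite +-identityʳ a | +-identityʳ (suc (a + triangle a)) | +-comm a (triangle a) = refl

⟪,⟫≡0 : ∀ a b → ⟪ a , b ⟫ ≡ 0 → a ≡ 0 × b ≡ 0
⟪,⟫≡0 zero    zero    _ = refl , refl
⟪,⟫≡0 zero    (suc b) ()
⟪,⟫≡0 (suc a) b       ()

nextPair : ℕ × ℕ → ℕ × ℕ
nextPair (zero  , b) = suc b , 0
nextPair (suc a , b) = a , suc b

unpair : ℕ → ℕ × ℕ
unpair = fold (0 , 0) nextPair

⟪nextPair⟫ : ∀ p → ⟪ proj₁ (nextPair p) , proj₂ (nextPair p) ⟫ ≡ suc ⟪ proj₁ p , proj₂ p ⟫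
⟪nextPair⟫ (zero  , b) = ⟪suc,0⟫ b
⟪nextPair⟫ (suc a , b) = ⟪,⟫-sucʳ a b

⟪unpair⟫ : ∀ w → ⟪ proj₁ (unpair w) , proj₂ (unpair w) ⟫ ≡ w
⟪unpair⟫ zero    = refl
⟪unpair⟫ (suc w) = trans (⟪nextPair⟫ (unpair w)) (cong suc (⟪unpair⟫ w))

unpair-⟪,⟫ : ∀ {w} a b → ⟪ a , b ⟫ ≡ w → unpair w ≡ (a , b)
unpair-⟪,⟫ {zero} a b eq with ⟪,⟫≡0 a b eq
... | refl , refl = refl
unpair-⟪,⟫ {suc w} a (suc b) eq
  rewrite unpair-⟪,⟫ (suc a) b (suc-injective (trans (sym (⟪,⟫-sucʳ a b)) eq)) = refl
unpair-⟪,⟫ {suc w} (suc a) zero eq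
  rewrite unpair-⟪,⟫ 0 a (suc-injective (trans (sym (⟪suc,0⟫ a)) eq)) = refl

opaque
  π₁ π₂ : ℕ → ℕ
  π₁ w = proj₁ (unpair w)
  π₂ w = proj₂ (unpair w)

  ⟪π₁,π₂⟫ : ∀ w → ⟪ π₁ w , π₂ w ⟫ ≡ w
  ⟪π₁,π₂⟫ = ⟪unpair⟫

  π₁-⟪,⟫ : ∀ a b → π₁ ⟪ a , b ⟫ ≡ a
  π₁-⟪,⟫ a b = cong proj₁ (unpair-⟪,⟫ a b refl)

  π₂-⟪,⟫ : ∀ a b → π₂ ⟪ a , b ⟫ ≡ b
  π₂-⟪,⟫ a b = cong proj₂ (unpair-⟪,⟫ a b refl)

⟪,⟫-injectiveˡ : ∀ {a b c d} → ⟪ a , b ⟫ ≡ ⟪ c , d ⟫ → a ≡ c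
⟪,⟫-injectiveˡ {a} {b} {c} {d} eq = trans (sym (π₁-⟪,⟫ a b)) (trans (cong π₁ eq) (π₁-⟪,⟫ c d))

tick : ℕ × ℕ → ℕ × ℕ
tick (q , 7) = suc q , 0
tick (q , r) = q , suc r

divMod8 : ℕ → ℕ × ℕ
divMod8 = fold (0 , 0) tick

divMod8-8* : ∀ k → divMod8 (8 * k) ≡ (k , 0)
divMod8-8* zero    = refl
divMod8-8* (suc k) = begin
  divMod8 (8 * suc k)              ≡⟨ cong divMod8 (*-suc 8 k) ⟩
  divMod8 (8 + 8 * k)              ≡⟨ fold-+ (0 , 0) tick 8 {8 * k} ⟩
  fold (divMod8 (8 * k)) tick 8    ≡⟨ cong (λ p → fold p tick 8) (divMod8-8* k) ⟩
  (suc k , 0)                      ∎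
  where open ≡-Reasoning

fold-tick : ∀ {q} t → t < 8 → fold (q , 0) tick t ≡ (q , t)
fold-tick 0 _ = refl
fold-tick 1 _ = refl
fold-tick 2 _ = refl
fold-tick 3 _ = refl
fold-tick 4 _ = refl
fold-tick 5 _ = refl
fold-tick 6 _ = refl
fold-tick 7 _ = refl
fold-tick (suc (suc (suc (suc (suc (suc (suc (suc _)))))))) (s≤s (s≤s (s≤s (s≤s (s≤s (s≤s (s≤s (s≤s ()))))))))

divMod8-unique : ∀ {t} k → t < 8 → divMod8 (t + 8 * k) ≡ (k , t)
divMod8-unique {t} k t<8 =
  trans (fold-+ (0 , 0) tick t {8 * k}) (trans (cong (λ p → fold p tick t) (divMod8-8* k)) (fold-tick t t<8))

divMod8-correct : ∀ e → divMod8 e ≡ (e / 8 , e % 8)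
divMod8-correct e = subst (λ n → divMod8 n ≡ (e / 8 , e % 8)) (sym e≡r+8q) (divMod8-unique (e / 8) (m%n<n e 8))
  where
  e≡r+8q : e ≡ e % 8 + 8 * (e / 8)
  e≡r+8q = trans (m≡m%n+[m/n]*n e 8) (cong (e % 8 +_) (*-comm (e / 8) 8))

-- The codes t + 8 * k with t < 4 ignore k; keeping it in the instruction makes the coding bijective.
data Instr : Set where
  zeroᴵ succᴵ fstᴵ sndᴵ : ℕ → Instr
  compᴵ pairᴵ recᴵ      : ℕ → ℕ → Instr
  muᴵ                   : ℕ → Instr

tag payload : Instr → ℕ
tag (zeroᴵ _)   = 0
tag (succᴵ _)   = 1
tag (fstᴵ _)    = 2
tag (sndᴵ _)    = 3
tag (compᴵ _ _) = 4
tag (pairᴵ _ _) = 5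
tag (recᴵ _ _)  = 6
tag (muᴵ _)     = 7

payload (zeroᴵ k)   = k
payload (succᴵ k)   = k
payload (fstᴵ k)    = k
payload (sndᴵ k)    = k
payload (compᴵ a b) = ⟪ a , b ⟫
payload (pairᴵ a b) = ⟪ a , b ⟫
payload (recᴵ a b)  = ⟪ a , b ⟫
payload (muᴵ a)     = a

instr : ℕ → ℕ → Instr
instr 0 k = zeroᴵ k
instr 1 k = succᴵ k
instr 2 k = fstᴵ k
instr 3 k = sndᴵ k
instr 4 k = compᴵ (π₁ k) (π₂ k)
instr 5 k = pairᴵ (π₁ k) (π₂ k)
instr 6 k = recᴵ (π₁ k) (π₂ k)
instr _ k = muᴵ k

decode : ℕ → Instr
decode e = instr (e % 8) (e / 8)

instr-tag-payload : ∀ i → instr (tag i) (payload i) ≡ i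
instr-tag-payload (zeroᴵ k)   = refl
instr-tag-payload (succᴵ k)   = refl
instr-tag-payload (fstᴵ k)    = refl
instr-tag-payload (sndᴵ k)    = refl
instr-tag-payload (compᴵ a b) = cong₂ compᴵ (π₁-⟪,⟫ a b) (π₂-⟪,⟫ a b)
instr-tag-payload (pairᴵ a b) = cong₂ pairᴵ (π₁-⟪,⟫ a b) (π₂-⟪,⟫ a b)
instr-tag-payload (recᴵ a b)  = cong₂ recᴵ (π₁-⟪,⟫ a b) (π₂-⟪,⟫ a b)
instr-tag-payload (muᴵ a)     = refl

tag<8 : ∀ i → tag i < 8
tag<8 (zeroᴵ _)   = s≤s z≤n
tag<8 (succᴵ _)   = s≤s (s≤s z≤n)
tag<8 (fstᴵ _)    = s≤s (s≤s (s≤s z≤n))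
tag<8 (sndᴵ _)    = s≤s (s≤s (s≤s (s≤s z≤n)))
tag<8 (compᴵ _ _) = s≤s (s≤s (s≤s (s≤s (s≤s z≤n))))
tag<8 (pairᴵ _ _) = s≤s (s≤s (s≤s (s≤s (s≤s (s≤s z≤n)))))
tag<8 (recᴵ _ _)  = s≤s (s≤s (s≤s (s≤s (s≤s (s≤s (s≤s z≤n))))))
tag<8 (muᴵ _)     = s≤s (s≤s (s≤s (s≤s (s≤s (s≤s (s≤s (s≤s z≤n)))))))

tag-instr : ∀ {r} q → r < 8 → tag (instr r q) ≡ r × payload (instr r q) ≡ q
tag-instr {0} q _ = refl , refl
tag-instr {1} q _ = refl , refl
tag-instr {2} q _ = refl , refl
tag-instr {3} q _ = refl , refl
tag-instr {4} q _ = refl , ⟪π₁,π₂⟫ q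
tag-instr {5} q _ = refl , ⟪π₁,π₂⟫ q
tag-instr {6} q _ = refl , ⟪π₁,π₂⟫ q
tag-instr {7} q _ = refl , refl
tag-instr {suc (suc (suc (suc (suc (suc (suc (suc _)))))))} q (s≤s (s≤s (s≤s (s≤s (s≤s (s≤s (s≤s (s≤s ()))))))))

decode-spec : ∀ e → e ≡ tag (decode e) + 8 * payload (decode e)
decode-spec e with tag-instr (e / 8) (m%n<n e 8)
... | t≡ , p≡ rewrite t≡ | p≡ = trans (m≡m%n+[m/n]*n e 8) (cong (e % 8 +_) (*-comm (e / 8) 8))

decode-tag : ∀ {e} i → e ≡ tag i + 8 * payload i → decode e ≡ i
decode-tag {e} i e≡ = trans (cong₂ instr (cong proj₂ qr) (cong proj₁ qr)) (instr-tag-payload i)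
  where
  qr : (e / 8 , e % 8) ≡ (payload i , tag i)
  qr = trans (sym (divMod8-correct e))
             (subst (λ n → divMod8 n ≡ (payload i , tag i)) (sym e≡) (divMod8-unique (payload i) (tag<8 i)))

opaque
  ⌜_⌝ : Instr → ℕ
  ⌜ i ⌝ = tag i + 8 * payload i

  ⌜⌝-def : ∀ i → ⌜ i ⌝ ≡ tag i + 8 * payload i
  ⌜⌝-def i = refl

⌜⌝-injective : ∀ {i j} → ⌜ i ⌝ ≡ ⌜ j ⌝ → i ≡ j
⌜⌝-injective {i} {j} eq = trans (sym (decode-tag i (⌜⌝-def i))) (decode-tag j (trans eq (⌜⌝-def j)))

-- A stack machine evaluating Φ

data Frame : Set where
  compF  : ℕ → Frame
  pairˡF : ℕ → ℕ → Frame
  pairʳF : ℕ → Frame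
  recF   : ℕ → ℕ → ℕ → Frame
  muF    : ℕ → ℕ → ℕ → Frame

Stack : Set
Stack = List Frame

data State : Set where
  eval   : ℕ → ℕ → Stack → State
  return : ℕ → Stack → State

recurse : ℕ → ℕ → ℕ → ℕ → ℕ → Stack → State
recurse zero    e a b x K = eval a x K
recurse (suc n) e a b x K = eval e ⟪ x , n ⟫ (recF b x n ∷ K)

exec : Instr → ℕ → ℕ → Stack → State
exec (zeroᴵ _)   e x K = return 0 K
exec (succᴵ _)   e x K = return (suc x) K
exec (fstᴵ _)    e x K = return (π₁ x) K
exec (sndᴵ _)    e x K = return (π₂ x) K
exec (compᴵ a b) e x K = eval b x (compF a ∷ K)
exec (pairᴵ a b) e x K = eval a x (pairˡF b x ∷ K)
exec (recᴵ a b)  e x K = recurse (π₂ x) e a b (π₁ x) K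
exec (muᴵ a)     e x K = eval a ⟪ x , 0 ⟫ (muF a x 0 ∷ K)

resume : ℕ → Stack → State
resume v       []                = return v []
resume v       (compF a ∷ K)     = eval a v K
resume v       (pairˡF b x ∷ K)  = eval b x (pairʳF v ∷ K)
resume v       (pairʳF y ∷ K)    = return ⟪ y , v ⟫ K
resume v       (recF b x n ∷ K)  = eval b ⟪ x , ⟪ n , v ⟫ ⟫ K
resume zero    (muF a x n ∷ K)   = return n K
resume (suc _) (muF a x n ∷ K)   = eval a ⟪ x , suc n ⟫ (muF a x (suc n) ∷ K)

step : State → State
step (eval e x K) = exec (decode e) e x K
step (return v K) = resume v K

run : ℕ → State → State
run zero    st = st
run (suc n) st = run n (step st)

run-+ : ∀ m n st → run (m + n) st ≡ run n (run m st)
run-+ zero    n st = refl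
run-+ (suc m) n st = run-+ m n (step st)

run-seq : ∀ m n {st st′ st″} → run m st ≡ st′ → run n st′ ≡ st″ → run (m + n) st ≡ st″
run-seq m n {st} refl eq = trans (run-+ m n st) eq

run-halted : ∀ n v → run n (return v []) ≡ return v []
run-halted zero    v = refl
run-halted (suc n) v = run-halted n v

return-injective : ∀ {u v K} → return u K ≡ return v K → u ≡ v
return-injective refl = refl

run-eval : ∀ n {e x K} i → e ≡ tag i + 8 * payload i → run (suc n) (eval e x K) ≡ run n (exec i e x K)
run-eval n {e} {x} {K} i e≡ = cong (λ j → run n (exec j e x K)) (decode-tag i e≡)

Runs : ℕ → ℕ → ℕ → Set
Runs e x y = ∃ λ s → ∀ K → run s (eval e x K) ≡ return y K

PositiveBelow : ℕ → ℕ → ℕ → Set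
PositiveBelow a x n = ∀ m → m < n → ∃ λ v → Eval a ⟪ x , m ⟫ (suc v)

mutual
  Eval⇒Runs : ∀ {e x y} → Eval e x y → Runs e x y
  Eval⇒Runs (ev-zero {k = k} e≡) = 1 , λ K → run-eval 0 (zeroᴵ k) e≡
  Eval⇒Runs (ev-succ {k = k} e≡) = 1 , λ K → run-eval 0 (succᴵ k) e≡
  Eval⇒Runs (ev-fst {k = k} {a = a} {b} e≡ refl) = 1 , λ K →
    trans (run-eval 0 (fstᴵ k) e≡) (cong (λ u → return u K) (π₁-⟪,⟫ a b))
  Eval⇒Runs (ev-snd {k = k} {a = a} {b} e≡ refl) = 1 , λ K →
    trans (run-eval 0 (sndᴵ k) e≡) (cong (λ u → return u K) (π₂-⟪,⟫ a b))
  Eval⇒Runs (ev-comp {a = a} {b} {x} e≡ d₁ d₂) with Eval⇒Runs d₁ | Eval⇒Runs d₂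
  ... | s₁ , h₁ | s₂ , h₂ = suc (s₁ + suc s₂) , λ K →
    trans (run-eval (s₁ + suc s₂) (compᴵ a b) e≡) (run-seq s₁ (suc s₂) (h₁ (compF a ∷ K)) (h₂ K))
  Eval⇒Runs (ev-pair {a = a} {b} {x} {y} e≡ d₁ d₂) with Eval⇒Runs d₁ | Eval⇒Runs d₂
  ... | s₁ , h₁ | s₂ , h₂ = suc (s₁ + suc (s₂ + 1)) , λ K →
    trans (run-eval (s₁ + suc (s₂ + 1)) (pairᴵ a b) e≡)
          (run-seq s₁ (suc (s₂ + 1)) (h₁ (pairˡF b x ∷ K)) (run-seq s₂ 1 (h₂ (pairʳF y ∷ K)) refl))
  Eval⇒Runs (ev-rec0 {e} {a} {b} {x} e≡ d) with Eval⇒Runs d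
  ... | s , h = suc s , λ K →
    trans (run-eval s (recᴵ a b) e≡)
          (trans (cong₂ (λ n u → run s (recurse n e a b u K)) (π₂-⟪,⟫ x 0) (π₁-⟪,⟫ x 0)) (h K))
  Eval⇒Runs (ev-recS {e} {a} {b} {x} {n} e≡ d₁ d₂) with Eval⇒Runs d₁ | Eval⇒Runs d₂
  ... | s₁ , h₁ | s₂ , h₂ = suc (s₁ + suc s₂) , λ K →
    trans (run-eval (s₁ + suc s₂) (recᴵ a b) e≡)
          (trans (cong₂ (λ m u → run (s₁ + suc s₂) (recurse m e a b u K)) (π₂-⟪,⟫ x (suc n)) (π₁-⟪,⟫ x (suc n)))
                 (run-seq s₁ (suc s₂) (h₁ (recF b x n ∷ K)) (h₂ K)))
  Eval⇒Runs (ev-mu {a = a} {x} {n} e≡ d₀ below) with mu-search {a} {x} below (Eval⇒Runs d₀) n 0 refl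
  ... | s , h = suc s , λ K → trans (run-eval s (muᴵ a) e≡) (h K)

  mu-search : ∀ {a x n} → PositiveBelow a x n → Runs a ⟪ x , n ⟫ 0 →
              ∀ d m → m + d ≡ n → ∃ λ s → ∀ K → run s (eval a ⟪ x , m ⟫ (muF a x m ∷ K)) ≡ return n K
  mu-search {a} {x} below (s , h) zero m refl rewrite +-identityʳ m =
    s + 1 , λ K → run-seq s 1 (h (muF a x m ∷ K)) refl
  mu-search {a} {x} below found (suc d) m m+d≡n with below m (subst (m <_) m+d≡n (m<m+n m z<s))
  ... | v , dm with Eval⇒Runs dm | mu-search {a} {x} below found d (suc m) (trans (sym (+-suc m d)) m+d≡n)
  ... | s₁ , h₁ | s₂ , h₂ = s₁ + suc s₂ , λ K → run-seq s₁ (suc s₂) (h₁ (muF a x m ∷ K)) (h₂ K)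

Returns : ℕ → ℕ → ℕ → Stack → ℕ → Set
Returns s e x K w = ∃ λ y → Eval e x y × ∃ λ s′ → s′ < s × run s′ (return y K) ≡ return w []

suc<⇒<suc : ∀ {m n} → suc m < n → m < suc n
suc<⇒<suc {m} m<n = m<n⇒m<1+n (<-trans (n<1+n m) m<n)

mutual
  Runs⇒Eval : ∀ {s e x K w} → Acc _<_ s → run s (eval e x K) ≡ return w [] → Returns s e x K w
  Runs⇒Eval {zero} _ ()
  Runs⇒Eval {suc s} {e} {x} {K} (acc below) halts with decode e | decode-spec e
  ... | zeroᴵ k | e≡ = 0 , ev-zero {k = k} e≡ , s , n<1+n s , halts
  ... | succᴵ k | e≡ = suc x , ev-succ {k = k} e≡ , s , n<1+n s , halts
  ... | fstᴵ k  | e≡ = π₁ x , ev-fst {k = k} {b = π₂ x} e≡ (sym (⟪π₁,π₂⟫ x)) , s , n<1+n s , halts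
  ... | sndᴵ k  | e≡ = π₂ x , ev-snd {k = k} {a = π₁ x} e≡ (sym (⟪π₁,π₂⟫ x)) , s , n<1+n s , halts
  ... | compᴵ a b | e≡ with Runs⇒Eval (below (n<1+n s)) halts
  ... | z , d₁ , zero , _ , ()
  ... | z , d₁ , suc s₁ , s₁<s , halts₁ with Runs⇒Eval (below (suc<⇒<suc s₁<s)) halts₁
  ... | y , d₂ , s₂ , s₂<s₁ , halts₂ = y , ev-comp e≡ d₁ d₂ , s₂ , <-trans s₂<s₁ (suc<⇒<suc s₁<s) , halts₂
  Runs⇒Eval {suc s} (acc below) halts | pairᴵ a b | e≡ with Runs⇒Eval (below (n<1+n s)) halts
  ... | y₁ , d₁ , zero , _ , ()
  ... | y₁ , d₁ , suc s₁ , s₁<s , halts₁ with Runs⇒Eval (below (suc<⇒<suc s₁<s)) halts₁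
  ... | y₂ , d₂ , zero , _ , ()
  ... | y₂ , d₂ , suc s₂ , s₂<s₁ , halts₂ =
    ⟪ y₁ , y₂ ⟫ , ev-pair e≡ d₁ d₂ , s₂ , <-trans (n<1+n s₂) (<-trans s₂<s₁ (suc<⇒<suc s₁<s)) , halts₂
  Runs⇒Eval {suc s} {e} {x} {K} {w} (acc below) halts | recᴵ a b | e≡ = unfold (π₂ x) (⟪π₁,π₂⟫ x) halts
    where
    unfold : ∀ n → ⟪ π₁ x , n ⟫ ≡ x → run s (recurse n e a b (π₁ x) K) ≡ return w [] → Returns (suc s) e x K w
    unfold zero x≡ halts′ with Runs⇒Eval (below (n<1+n s)) halts′
    ... | y , d , s₁ , s₁<s , halts₁ =
      y , subst (λ u → Eval e u y) x≡ (ev-rec0 {a = a} {b} e≡ d) , s₁ , m<n⇒m<1+n s₁<s , halts₁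
    unfold (suc n) x≡ halts′ with Runs⇒Eval (below (n<1+n s)) halts′
    ... | z , d₁ , zero , _ , ()
    ... | z , d₁ , suc s₁ , s₁<s , halts₁ with Runs⇒Eval (below (suc<⇒<suc s₁<s)) halts₁
    ... | y , d₂ , s₂ , s₂<s₁ , halts₂ =
      y , subst (λ u → Eval e u y) x≡ (ev-recS {a = a} {b} {π₁ x} {n} e≡ d₁ d₂) ,
      s₂ , <-trans s₂<s₁ (suc<⇒<suc s₁<s) , halts₂
  Runs⇒Eval {suc s} (acc below) halts | muᴵ a | e≡ with Runs⇒Eval-mu (below (n<1+n s)) (λ _ ()) halts
  ... | n , d₀ , positive , s₁ , s₁≤s , halts₁ = n , ev-mu e≡ d₀ positive , s₁ , s≤s s₁≤s , halts₁

  Runs⇒Eval-mu : ∀ {s a x n K w} → Acc _<_ s → PositiveBelow a x n →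
                 run s (eval a ⟪ x , n ⟫ (muF a x n ∷ K)) ≡ return w [] →
                 ∃ λ N → Eval a ⟪ x , N ⟫ 0 × PositiveBelow a x N ×
                         ∃ λ s′ → s′ ≤ s × run s′ (return N K) ≡ return w []
  Runs⇒Eval-mu {s} {a} {x} {n} (acc below) positive halts with Runs⇒Eval (acc below) halts
  ... | _ , _ , zero , _ , ()
  ... | zero , d , suc s₁ , s₁<s , halts₁ = n , d , positive , s₁ , <⇒≤ (<-trans (n<1+n s₁) s₁<s) , halts₁
  ... | suc v , d , suc s₁ , s₁<s , halts₁ with Runs⇒Eval-mu (below (<-trans (n<1+n s₁) s₁<s)) (extend v d) halts₁
    where
    extend : ∀ v → Eval a ⟪ x , n ⟫ (suc v) → PositiveBelow a x (suc n)
    extend v d m m<1+n with m<1+n⇒m<n∨m≡n m<1+n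
    ... | inj₁ m<n  = positive m m<n
    ... | inj₂ refl = v , d
  ... | N , d₀ , positive′ , s₂ , s₂≤s₁ , halts₂ =
    N , d₀ , positive′ , s₂ , ≤-trans s₂≤s₁ (<⇒≤ (<-trans (n<1+n s₁) s₁<s)) , halts₂

HaltsWithin : ℕ → ℕ → ℕ → ℕ → Set
HaltsWithin z e x v = run z (eval e x []) ≡ return v []

HaltsWithin-mono : ∀ {z z′ e x v} → z ≤ z′ → HaltsWithin z e x v → HaltsWithin z′ e x v
HaltsWithin-mono {z} {z′} {e} {x} {v} z≤z′ halts = begin
  run z′ (eval e x [])               ≡⟨ cong (λ n → run n (eval e x [])) (sym (m+[n∸m]≡n z≤z′)) ⟩
  run (z + (z′ ∸ z)) (eval e x [])   ≡⟨ run-seq z (z′ ∸ z) halts (run-halted (z′ ∸ z) v) ⟩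
  return v []                        ∎
  where open ≡-Reasoning

Eval⇒HaltsWithin : ∀ {e x v} → Eval e x v → ∃ λ z → HaltsWithin z e x v
Eval⇒HaltsWithin d with Eval⇒Runs d
... | s , h = s , h []

HaltsWithin⇒Eval : ∀ {s e x y} → HaltsWithin s e x y → Eval e x y
HaltsWithin⇒Eval {s} {e} {x} halts with Runs⇒Eval (<-wellFounded s) halts
... | y′ , d , s′ , _ , halts′ = subst (Eval e x) (return-injective (trans (sym (run-halted s′ y′)) halts′)) d

Eval-deterministic : ∀ {e x y y′} → Eval e x y → Eval e x y′ → y ≡ y′
Eval-deterministic {e} {x} {y} {y′} d d′ with Eval⇒Runs d | Eval⇒Runs d′
... | s , h | s′ , h′ = return-injective (begin
    return y []                      ≡⟨ sym (run-halted s′ y) ⟩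
    run s′ (return y [])             ≡⟨ sym (run-seq s s′ (h []) refl) ⟩
    run (s + s′) (eval e x [])       ≡⟨ cong (λ n → run n (eval e x [])) (+-comm s s′) ⟩
    run (s′ + s) (eval e x [])       ≡⟨ run-seq s′ s (h′ []) (run-halted s y′) ⟩
    return y′ []                     ∎)
  where open ≡-Reasoning

record Computable (f : ℕ → ℕ) : Set where
  constructor computable
  field
    code      : ℕ
    evaluates : ∀ x → Eval code x (f x)
open Computable public

computable-≗ : ∀ {f g} → f ≗ g → Computable f → Computable g
computable-≗ f≗g (computable c ev) = computable c (λ x → subst (Eval c x) (f≗g x) (ev x))

zeroᶜ : Computable (λ _ → 0)
zeroᶜ = computable ⌜ zeroᴵ 0 ⌝ (λ _ → ev-zero {k = 0} (⌜⌝-def (zeroᴵ 0)))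

sucᶜ : Computable suc
sucᶜ = computable ⌜ succᴵ 0 ⌝ (λ _ → ev-succ {k = 0} (⌜⌝-def (succᴵ 0)))

π₁ᶜ : Computable π₁
π₁ᶜ = computable ⌜ fstᴵ 0 ⌝ (λ x → ev-fst {k = 0} {b = π₂ x} (⌜⌝-def (fstᴵ 0)) (sym (⟪π₁,π₂⟫ x)))

π₂ᶜ : Computable π₂
π₂ᶜ = computable ⌜ sndᴵ 0 ⌝ (λ x → ev-snd {k = 0} {a = π₁ x} (⌜⌝-def (sndᴵ 0)) (sym (⟪π₁,π₂⟫ x)))

infixr 9 _∘ᶜ_
_∘ᶜ_ : ∀ {f g} → Computable f → Computable g → Computable (f ∘ g)
_∘ᶜ_ {g = g} cf cg =
  computable ⌜ compᴵ (code cf) (code cg) ⌝ (λ x → ev-comp (⌜⌝-def (compᴵ _ _)) (evaluates cg x) (evaluates cf (g x)))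

⟨_,_⟩ᶜ : ∀ {f g} → Computable f → Computable g → Computable (λ x → ⟪ f x , g x ⟫)
⟨ cf , cg ⟩ᶜ =
  computable ⌜ pairᴵ (code cf) (code cg) ⌝ (λ x → ev-pair (⌜⌝-def (pairᴵ _ _)) (evaluates cf x) (evaluates cg x))

primRec : (ℕ → ℕ) → (ℕ → ℕ) → ℕ → ℕ → ℕ
primRec f g x zero    = f x
primRec f g x (suc n) = g ⟪ x , ⟪ n , primRec f g x n ⟫ ⟫

primRecᶜ : ∀ {f g} → Computable f → Computable g → Computable (λ w → primRec f g (π₁ w) (π₂ w))
primRecᶜ {f} {g} cf cg =
  computable c (λ w → subst (λ u → Eval c u (primRec f g (π₁ w) (π₂ w))) (⟪π₁,π₂⟫ w) (ev (π₁ w) (π₂ w)))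
  where
  c = ⌜ recᴵ (code cf) (code cg) ⌝
  ev : ∀ x n → Eval c ⟪ x , n ⟫ (primRec f g x n)
  ev x zero    = ev-rec0 {a = code cf} {b = code cg} (⌜⌝-def (recᴵ _ _)) (evaluates cf x)
  ev x (suc n) = ev-recS {a = code cf} {b = code cg} {x} {n} (⌜⌝-def (recᴵ _ _)) (ev x n) (evaluates cg _)

idᶜ : Computable id
idᶜ = computable-≗ ⟪π₁,π₂⟫ ⟨ π₁ᶜ , π₂ᶜ ⟩ᶜ

constCode : ℕ → ℕ
constCode zero    = ⌜ zeroᴵ 0 ⌝
constCode (suc n) = ⌜ compᴵ ⌜ succᴵ 0 ⌝ (constCode n) ⌝

Eval-constCode : ∀ n x → Eval (constCode n) x n
Eval-constCode zero    x = evaluates zeroᶜ x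
Eval-constCode (suc n) x = evaluates (sucᶜ ∘ᶜ computable (constCode n) (Eval-constCode n)) x

constᶜ : ∀ n → Computable (λ _ → n)
constᶜ n = computable (constCode n) (Eval-constCode n)

foldᶜ : ∀ {g} → Computable g → Computable (λ w → fold (π₁ w) g (π₂ w))
foldᶜ {g} cg = computable-≗ (λ w → primRec-fold (π₁ w) (π₂ w)) (primRecᶜ idᶜ (cg ∘ᶜ π₂ᶜ ∘ᶜ π₂ᶜ))
  where
  primRec-fold : ∀ x n → primRec id (g ∘ π₂ ∘ π₂) x n ≡ fold x g n
  primRec-fold x zero    = refl
  primRec-fold x (suc n)
    rewrite π₂-⟪,⟫ x ⟪ n , primRec id (g ∘ π₂ ∘ π₂) x n ⟫ | π₂-⟪,⟫ n (primRec id (g ∘ π₂ ∘ π₂) x n) =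
    cong g (primRec-fold x n)

predᶜ : Computable pred
predᶜ = computable-≗ primRec-pred (primRecᶜ zeroᶜ (π₁ᶜ ∘ᶜ π₂ᶜ) ∘ᶜ ⟨ zeroᶜ , idᶜ ⟩ᶜ)
  where
  primRec-pred : ∀ x → primRec (λ _ → 0) (π₁ ∘ π₂) (π₁ ⟪ 0 , x ⟫) (π₂ ⟪ 0 , x ⟫) ≡ pred x
  primRec-pred x rewrite π₁-⟪,⟫ 0 x | π₂-⟪,⟫ 0 x = go x
    where
    go : ∀ x → primRec (λ _ → 0) (π₁ ∘ π₂) 0 x ≡ pred x
    go zero    = refl
    go (suc n) = trans (cong π₁ (π₂-⟪,⟫ 0 _)) (π₁-⟪,⟫ n _)

data Expr : Set where
  var            : Expr
  lit            : ℕ → Expr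
  sucₑ           : Expr → Expr
  ⟨_,_⟩ₑ          : Expr → Expr → Expr
  fstₑ sndₑ predₑ : Expr → Expr
  ifzₑ_then_else_ : Expr → Expr → Expr → Expr
  app            : ∀ {f} → Computable f → Expr → Expr

ifz : ∀ {A : Set} → ℕ → A → A → A
ifz zero    a b = a
ifz (suc _) a b = b

⟦_⟧ : Expr → ℕ → ℕ
⟦ var ⟧                  w = w
⟦ lit n ⟧                w = n
⟦ sucₑ t ⟧               w = suc (⟦ t ⟧ w)
⟦ ⟨ t , u ⟩ₑ ⟧            w = ⟪ ⟦ t ⟧ w , ⟦ u ⟧ w ⟫
⟦ fstₑ t ⟧               w = π₁ (⟦ t ⟧ w)
⟦ sndₑ t ⟧               w = π₂ (⟦ t ⟧ w)
⟦ predₑ t ⟧              w = pred (⟦ t ⟧ w)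
⟦ ifzₑ t then u else u′ ⟧ w = ifz (⟦ t ⟧ w) (⟦ u ⟧ w) (⟦ u′ ⟧ w)
⟦ app {f} _ t ⟧          w = f (⟦ t ⟧ w)

ifzᶜ : Computable (λ w → ifz (π₂ w) (π₁ (π₁ w)) (π₂ (π₁ w)))
ifzᶜ = computable-≗ (λ w → primRec-ifz (π₁ w) (π₂ w)) (primRecᶜ π₁ᶜ (π₂ᶜ ∘ᶜ π₁ᶜ))
  where
  primRec-ifz : ∀ x n → primRec π₁ (π₂ ∘ π₁) x n ≡ ifz n (π₁ x) (π₂ x)
  primRec-ifz x zero    = refl
  primRec-ifz x (suc n) = cong π₂ (π₁-⟪,⟫ x _)

compile : ∀ t → Computable ⟦ t ⟧
compile var           = idᶜ
compile (lit n)       = constᶜ n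
compile (sucₑ t)      = sucᶜ ∘ᶜ compile t
compile ⟨ t , u ⟩ₑ     = ⟨ compile t , compile u ⟩ᶜ
compile (fstₑ t)      = π₁ᶜ ∘ᶜ compile t
compile (sndₑ t)      = π₂ᶜ ∘ᶜ compile t
compile (predₑ t)     = predᶜ ∘ᶜ compile t
compile (ifzₑ t then u else u′) = computable-≗ select (ifzᶜ ∘ᶜ ⟨ ⟨ compile u , compile u′ ⟩ᶜ , compile t ⟩ᶜ)
  where
  select : ∀ w → let p = ⟪ ⟪ ⟦ u ⟧ w , ⟦ u′ ⟧ w ⟫ , ⟦ t ⟧ w ⟫ in
           ifz (π₂ p) (π₁ (π₁ p)) (π₂ (π₁ p)) ≡ ifz (⟦ t ⟧ w) (⟦ u ⟧ w) (⟦ u′ ⟧ w)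
  select w rewrite π₂-⟪,⟫ ⟪ ⟦ u ⟧ w , ⟦ u′ ⟧ w ⟫ (⟦ t ⟧ w) | π₁-⟪,⟫ ⟪ ⟦ u ⟧ w , ⟦ u′ ⟧ w ⟫ (⟦ t ⟧ w)
                 | π₁-⟪,⟫ (⟦ u ⟧ w) (⟦ u′ ⟧ w) | π₂-⟪,⟫ (⟦ u ⟧ w) (⟦ u′ ⟧ w) = refl
compile (app c t)     = c ∘ᶜ compile t

-- Evaluating an expression on an input presented as a tree of pairs: projections out of
-- a node then reduce, so that running a program on encoded data is a computation.
data Tree : Set where
  leaf : ℕ → Tree
  node : Tree → Tree → Tree

⌊_⌋ : Tree → ℕ
⌊ leaf n ⌋   = n
⌊ node a b ⌋ = ⟪ ⌊ a ⌋ , ⌊ b ⌋ ⟫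

first second : Tree → Tree
first (leaf n)   = leaf (π₁ n)
first (node a _) = a
second (leaf n)   = leaf (π₂ n)
second (node _ b) = b

⟦_⟧ᵀ : Expr → Tree → Tree
⟦ var ⟧ᵀ                  v = v
⟦ lit n ⟧ᵀ                v = leaf n
⟦ sucₑ t ⟧ᵀ               v = leaf (suc ⌊ ⟦ t ⟧ᵀ v ⌋)
⟦ ⟨ t , u ⟩ₑ ⟧ᵀ            v = node (⟦ t ⟧ᵀ v) (⟦ u ⟧ᵀ v)
⟦ fstₑ t ⟧ᵀ               v = first (⟦ t ⟧ᵀ v)
⟦ sndₑ t ⟧ᵀ               v = second (⟦ t ⟧ᵀ v)
⟦ predₑ t ⟧ᵀ              v = leaf (pred ⌊ ⟦ t ⟧ᵀ v ⌋)
⟦ ifzₑ t then u else u′ ⟧ᵀ v = ifz ⌊ ⟦ t ⟧ᵀ v ⌋ (⟦ u ⟧ᵀ v) (⟦ u′ ⟧ᵀ v)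
⟦ app {f} _ t ⟧ᵀ          v = leaf (f ⌊ ⟦ t ⟧ᵀ v ⌋)

⌊⟦⟧ᵀ⌋ : ∀ t v → ⌊ ⟦ t ⟧ᵀ v ⌋ ≡ ⟦ t ⟧ ⌊ v ⌋
⌊⟦⟧ᵀ⌋ var       v = refl
⌊⟦⟧ᵀ⌋ (lit n)   v = refl
⌊⟦⟧ᵀ⌋ (sucₑ t)  v = cong suc (⌊⟦⟧ᵀ⌋ t v)
⌊⟦⟧ᵀ⌋ ⟨ t , u ⟩ₑ v = cong₂ ⟪_,_⟫ (⌊⟦⟧ᵀ⌋ t v) (⌊⟦⟧ᵀ⌋ u v)
⌊⟦⟧ᵀ⌋ (fstₑ t)  v = trans (⌊first⌋ (⟦ t ⟧ᵀ v)) (cong π₁ (⌊⟦⟧ᵀ⌋ t v))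
  where
  ⌊first⌋ : ∀ a → ⌊ first a ⌋ ≡ π₁ ⌊ a ⌋
  ⌊first⌋ (leaf n)   = refl
  ⌊first⌋ (node a b) = sym (π₁-⟪,⟫ ⌊ a ⌋ ⌊ b ⌋)
⌊⟦⟧ᵀ⌋ (sndₑ t)  v = trans (⌊second⌋ (⟦ t ⟧ᵀ v)) (cong π₂ (⌊⟦⟧ᵀ⌋ t v))
  where
  ⌊second⌋ : ∀ a → ⌊ second a ⌋ ≡ π₂ ⌊ a ⌋
  ⌊second⌋ (leaf n)   = refl
  ⌊second⌋ (node a b) = sym (π₂-⟪,⟫ ⌊ a ⌋ ⌊ b ⌋)
⌊⟦⟧ᵀ⌋ (predₑ t) v = cong pred (⌊⟦⟧ᵀ⌋ t v)
⌊⟦⟧ᵀ⌋ (ifzₑ t then u else u′) v rewrite sym (⌊⟦⟧ᵀ⌋ t v) with ⌊ ⟦ t ⟧ᵀ v ⌋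
... | zero  = ⌊⟦⟧ᵀ⌋ u v
... | suc _ = ⌊⟦⟧ᵀ⌋ u′ v
⌊⟦⟧ᵀ⌋ (app {f} _ t) v = cong f (⌊⟦⟧ᵀ⌋ t v)

predⁿₑ : ℕ → Expr → Expr
predⁿₑ zero    t = t
predⁿₑ (suc n) t = predₑ (predⁿₑ n t)

tickₑ : Expr
tickₑ =
  ifzₑ r then ⟨ q , lit 1 ⟩ₑ else ifzₑ predⁿₑ 1 r then ⟨ q , lit 2 ⟩ₑ else
  ifzₑ predⁿₑ 2 r then ⟨ q , lit 3 ⟩ₑ else ifzₑ predⁿₑ 3 r then ⟨ q , lit 4 ⟩ₑ else
  ifzₑ predⁿₑ 4 r then ⟨ q , lit 5 ⟩ₑ else ifzₑ predⁿₑ 5 r then ⟨ q , lit 6 ⟩ₑ else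
  ifzₑ predⁿₑ 6 r then ⟨ q , lit 7 ⟩ₑ else ifzₑ predⁿₑ 7 r then ⟨ sucₑ q , lit 0 ⟩ₑ else ⟨ q , sucₑ r ⟩ₑ
  where
  q = fstₑ var
  r = sndₑ var

⟦tickₑ⟧ : ∀ q r → ⟦ tickₑ ⟧ ⟪ q , r ⟫ ≡ ⟪ proj₁ (tick (q , r)) , proj₂ (tick (q , r)) ⟫
⟦tickₑ⟧ q r = trans (sym (⌊⟦⟧ᵀ⌋ tickₑ (node (leaf q) (leaf r)))) (by-cases r)
  where
  by-cases : ∀ r → ⌊ ⟦ tickₑ ⟧ᵀ (node (leaf q) (leaf r)) ⌋ ≡ ⟪ proj₁ (tick (q , r)) , proj₂ (tick (q , r)) ⟫
  by-cases 0 = refl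
  by-cases 1 = refl
  by-cases 2 = refl
  by-cases 3 = refl
  by-cases 4 = refl
  by-cases 5 = refl
  by-cases 6 = refl
  by-cases 7 = refl
  by-cases (suc (suc (suc (suc (suc (suc (suc (suc _)))))))) = refl

divMod8ᶜ : Computable (λ e → ⟪ e / 8 , e % 8 ⟫)
divMod8ᶜ = computable-≗ fold-tickₑ (foldᶜ (compile tickₑ) ∘ᶜ ⟨ constᶜ 0 , idᶜ ⟩ᶜ)
  where
  fold-tickₑ : ∀ e → fold (π₁ ⟪ 0 , e ⟫) ⟦ tickₑ ⟧ (π₂ ⟪ 0 , e ⟫) ≡ ⟪ e / 8 , e % 8 ⟫
  fold-tickₑ e rewrite π₁-⟪,⟫ 0 e | π₂-⟪,⟫ 0 e =
    trans (go e) (cong (λ p → ⟪ proj₁ p , proj₂ p ⟫) (divMod8-correct e))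
    where
    go : ∀ e → fold 0 ⟦ tickₑ ⟧ e ≡ ⟪ proj₁ (divMod8 e) , proj₂ (divMod8 e) ⟫
    go zero    = refl
    go (suc e) rewrite go e = ⟦tickₑ⟧ (proj₁ (divMod8 e)) (proj₂ (divMod8 e))

mod8ᶜ : Computable (_% 8)
mod8ᶜ = computable-≗ (λ e → π₂-⟪,⟫ (e / 8) (e % 8)) (π₂ᶜ ∘ᶜ divMod8ᶜ)

div8ᶜ : Computable (_/ 8)
div8ᶜ = computable-≗ (λ e → π₁-⟪,⟫ (e / 8) (e % 8)) (π₁ᶜ ∘ᶜ divMod8ᶜ)

frameᵀ : Frame → Tree
frameᵀ (compF a)    = node (leaf 0) (leaf a)
frameᵀ (pairˡF b x) = node (leaf 1) (node (leaf b) (leaf x))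
frameᵀ (pairʳF y)   = node (leaf 2) (leaf y)
frameᵀ (recF b x n) = node (leaf 3) (node (leaf b) (node (leaf x) (leaf n)))
frameᵀ (muF a x n)  = node (leaf 4) (node (leaf a) (node (leaf x) (leaf n)))

encStack : Stack → ℕ
encStack []      = 0
encStack (f ∷ K) = suc ⟪ ⌊ frameᵀ f ⌋ , encStack K ⟫

stateᵀ : State → Tree
stateᵀ (eval e x K) = node (leaf 0) (node (leaf e) (node (leaf x) (leaf (encStack K))))
stateᵀ (return v K) = node (leaf 1) (node (leaf v) (leaf (encStack K)))

encState : State → ℕ
encState st = ⌊ stateᵀ st ⌋

evalₑ : Expr → Expr → Expr → Expr
evalₑ e x K = ⟨ lit 0 , ⟨ e , ⟨ x , K ⟩ₑ ⟩ₑ ⟩ₑ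

returnₑ : Expr → Expr → Expr
returnₑ v K = ⟨ lit 1 , ⟨ v , K ⟩ₑ ⟩ₑ

pushₑ : Expr → Expr → Expr
pushₑ f K = sucₑ ⟨ f , K ⟩ₑ

execₑ : Expr
execₑ =
  ifzₑ t then returnₑ (lit 0) K else
  ifzₑ predⁿₑ 1 t then returnₑ (sucₑ x) K else
  ifzₑ predⁿₑ 2 t then returnₑ (fstₑ x) K else
  ifzₑ predⁿₑ 3 t then returnₑ (sndₑ x) K else
  ifzₑ predⁿₑ 4 t then evalₑ (sndₑ k) x (pushₑ ⟨ lit 0 , fstₑ k ⟩ₑ K) else
  ifzₑ predⁿₑ 5 t then evalₑ (fstₑ k) x (pushₑ ⟨ lit 1 , ⟨ sndₑ k , x ⟩ₑ ⟩ₑ K) else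
  ifzₑ predⁿₑ 6 t then
    (ifzₑ sndₑ x then evalₑ (fstₑ k) (fstₑ x) K
     else evalₑ e ⟨ fstₑ x , predₑ (sndₑ x) ⟩ₑ
                (pushₑ ⟨ lit 3 , ⟨ sndₑ k , ⟨ fstₑ x , predₑ (sndₑ x) ⟩ₑ ⟩ₑ ⟩ₑ K)) else
  evalₑ k ⟨ x , lit 0 ⟩ₑ (pushₑ ⟨ lit 4 , ⟨ k , ⟨ x , lit 0 ⟩ₑ ⟩ₑ ⟩ₑ K)
  where
  e = fstₑ (sndₑ var)
  x = fstₑ (sndₑ (sndₑ var))
  K = sndₑ (sndₑ (sndₑ var))
  t = app mod8ᶜ e
  k = app div8ᶜ e

-- The input is ⟨ v , ⟨ frame , K ⟩ ⟩.
resumeFrameₑ : Expr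
resumeFrameₑ =
  ifzₑ t then evalₑ p v K else
  ifzₑ predⁿₑ 1 t then evalₑ (fstₑ p) (sndₑ p) (pushₑ ⟨ lit 2 , v ⟩ₑ K) else
  ifzₑ predⁿₑ 2 t then returnₑ ⟨ p , v ⟩ₑ K else
  ifzₑ predⁿₑ 3 t then evalₑ (fstₑ p) ⟨ fstₑ (sndₑ p) , ⟨ sndₑ (sndₑ p) , v ⟩ₑ ⟩ₑ K else
  ifzₑ v then returnₑ (sndₑ (sndₑ p)) K else
  evalₑ (fstₑ p) ⟨ fstₑ (sndₑ p) , sucₑ (sndₑ (sndₑ p)) ⟩ₑ
        (pushₑ ⟨ lit 4 , ⟨ fstₑ p , ⟨ fstₑ (sndₑ p) , sucₑ (sndₑ (sndₑ p)) ⟩ₑ ⟩ₑ ⟩ₑ K)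
  where
  v   = fstₑ var
  t   = fstₑ (fstₑ (sndₑ var))
  p   = sndₑ (fstₑ (sndₑ var))
  K   = sndₑ (sndₑ var)

stepₑ : Expr
stepₑ = ifzₑ fstₑ var then execₑ else
        ifzₑ K then returnₑ v (lit 0) else app (compile resumeFrameₑ) ⟨ v , predₑ K ⟩ₑ
  where
  v = fstₑ (sndₑ var)
  K = sndₑ (sndₑ var)

⟦stepₑ⟧ : ∀ st → ⟦ stepₑ ⟧ (encState st) ≡ encState (step st)
⟦stepₑ⟧ st = trans (sym (⌊⟦⟧ᵀ⌋ stepₑ (stateᵀ st))) (stepᵀ st)
  where
  resumeᵀ : ∀ v f K → ⌊ ⟦ resumeFrameₑ ⟧ᵀ (node (leaf v) (node (frameᵀ f) (leaf (encStack K)))) ⌋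
                      ≡ encState (resume v (f ∷ K))
  resumeᵀ v       (compF a)    K = refl
  resumeᵀ v       (pairˡF b x) K = refl
  resumeᵀ v       (pairʳF y)   K = refl
  resumeᵀ v       (recF b x n) K = refl
  resumeᵀ zero    (muF a x n)  K = refl
  resumeᵀ (suc v) (muF a x n)  K = refl

  stepᵀ : ∀ st → ⌊ ⟦ stepₑ ⟧ᵀ (stateᵀ st) ⌋ ≡ encState (step st)
  stepᵀ (eval e x K) with e % 8 | e / 8 | m%n<n e 8
  ... | 0 | k | _ = refl
  ... | 1 | k | _ = refl
  ... | 2 | k | _ = refl
  ... | 3 | k | _ = refl
  ... | 4 | k | _ = refl
  ... | 5 | k | _ = refl
  ... | 6 | k | _ with π₂ x
  ...   | zero  = refl
  ...   | suc n = refl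
  stepᵀ (eval e x K) | 7 | k | _ = refl
  stepᵀ (eval e x K) | suc (suc (suc (suc (suc (suc (suc (suc _))))))) | k | s≤s (s≤s (s≤s (s≤s (s≤s (s≤s (s≤s (s≤s ())))))))
  stepᵀ (return v [])      = refl
  stepᵀ (return v (f ∷ K)) =
    trans (sym (⌊⟦⟧ᵀ⌋ resumeFrameₑ (node (leaf v) (node (frameᵀ f) (leaf (encStack K)))))) (resumeᵀ v f K)

run-suc : ∀ n st → run (suc n) st ≡ step (run n st)
run-suc n st = trans (cong (λ m → run m st) (+-comm 1 n)) (run-+ n 1 st)

fold-stepₑ : ∀ n st → fold (encState st) ⟦ stepₑ ⟧ n ≡ encState (run n st)
fold-stepₑ zero    st = refl
fold-stepₑ (suc n) st = begin
  ⟦ stepₑ ⟧ (fold (encState st) ⟦ stepₑ ⟧ n)  ≡⟨ cong ⟦ stepₑ ⟧ (fold-stepₑ n st) ⟩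
  ⟦ stepₑ ⟧ (encState (run n st))             ≡⟨ ⟦stepₑ⟧ (run n st) ⟩
  encState (step (run n st))                 ≡⟨ cong encState (sym (run-suc n st)) ⟩
  encState (run (suc n) st)                  ∎
  where open ≡-Reasoning

-- The encoded state after z steps of evaluating e on x, as a function of ⟪ e , ⟪ x , z ⟫ ⟫; opaque,
-- so that it is not unfolded when applied to such a tuple.
opaque
  outcome : ℕ → ℕ
  outcome w = encState (run (π₂ (π₂ w)) (eval (π₁ w) (π₁ (π₂ w)) []))

  outcome-def : ∀ w → outcome w ≡ encState (run (π₂ (π₂ w)) (eval (π₁ w) (π₁ (π₂ w)) []))
  outcome-def w = refl

outcome-⟪,⟫ : ∀ e x z → outcome ⟪ e , ⟪ x , z ⟫ ⟫ ≡ encState (run z (eval e x []))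
outcome-⟪,⟫ e x z
  rewrite outcome-def ⟪ e , ⟪ x , z ⟫ ⟫ | π₁-⟪,⟫ e ⟪ x , z ⟫ | π₂-⟪,⟫ e ⟪ x , z ⟫ | π₁-⟪,⟫ x z | π₂-⟪,⟫ x z = refl

outcomeᶜ : Computable outcome
outcomeᶜ = computable-≗ fold≡outcome (compile (app (foldᶜ (compile stepₑ)) ⟨ evalₑ e x (lit 0) , z ⟩ₑ))
  where
  e = fstₑ var
  x = fstₑ (sndₑ var)
  z = sndₑ (sndₑ var)
  fold≡outcome : ∀ w → let s = ⟪ encState (eval (π₁ w) (π₁ (π₂ w)) []) , π₂ (π₂ w) ⟫ in
                 fold (π₁ s) ⟦ stepₑ ⟧ (π₂ s) ≡ outcome w
  fold≡outcome w rewrite outcome-def w | π₁-⟪,⟫ (encState (eval (π₁ w) (π₁ (π₂ w)) [])) (π₂ (π₂ w))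
                       | π₂-⟪,⟫ (encState (eval (π₁ w) (π₁ (π₂ w)) [])) (π₂ (π₂ w)) =
    fold-stepₑ (π₂ (π₂ w)) (eval (π₁ w) (π₁ (π₂ w)) [])

outcome-halted : ∀ z e x {v} → HaltsWithin z e x v →
                 let o = outcome ⟪ e , ⟪ x , z ⟫ ⟫ in π₁ o ≡ 1 × π₂ (π₂ o) ≡ 0 × π₁ (π₂ o) ≡ v
outcome-halted z e x {v} halts rewrite outcome-⟪,⟫ e x z | halts | π₁-⟪,⟫ 1 ⟪ v , 0 ⟫ | π₂-⟪,⟫ 1 ⟪ v , 0 ⟫
  | π₁-⟪,⟫ v 0 | π₂-⟪,⟫ v 0 = refl , refl , refl

halted-outcome : ∀ z e x → let o = outcome ⟪ e , ⟪ x , z ⟫ ⟫ in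
                 π₁ o ≡ 1 → π₂ (π₂ o) ≡ 0 → HaltsWithin z e x (π₁ (π₂ o))
halted-outcome z e x rewrite outcome-⟪,⟫ e x z = halted (run z (eval e x []))
  where
  halted : ∀ st → π₁ (encState st) ≡ 1 → π₂ (π₂ (encState st)) ≡ 0 → st ≡ return (π₁ (π₂ (encState st))) []
  halted (eval e x K) tag≡1 _ rewrite π₁-⟪,⟫ 0 ⟪ e , ⟪ x , encStack K ⟫ ⟫ with tag≡1
  ... | ()
  halted (return v K) _ K≡0
    rewrite π₂-⟪,⟫ 1 ⟪ v , encStack K ⟫ | π₁-⟪,⟫ v (encStack K) | π₂-⟪,⟫ v (encStack K) with K | K≡0
  ... | [] | _ = refl
  ... | f ∷ K′ | ()

-- CSC indices form a Π⁰₂ set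

data Formula : Set where
  is0 is1 isBit : Expr → Formula
  _∧ᶠ_ _⇒ᶠ_     : Formula → Formula → Formula

infixr 6 _∧ᶠ_
infixr 5 _⇒ᶠ_

Holds : (Expr → ℕ) → Formula → Set
Holds val (is0 t)   = val t ≡ 0
Holds val (is1 t)   = val t ≡ 1
Holds val (isBit t) = val t ≤ 1
Holds val (φ ∧ᶠ ψ)  = Holds val φ × Holds val ψ
Holds val (φ ⇒ᶠ ψ)  = Holds val φ → Holds val ψ

Holds-cong : ∀ {val val′} → (∀ t → val t ≡ val′ t) → ∀ φ → Holds val φ ⇔ Holds val′ φ
Holds-cong val≡ (is0 t)   = mk⇔ (trans (sym (val≡ t))) (trans (val≡ t))
Holds-cong val≡ (is1 t)   = mk⇔ (trans (sym (val≡ t))) (trans (val≡ t))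
Holds-cong val≡ (isBit t) = mk⇔ (subst (_≤ 1) (val≡ t)) (subst (_≤ 1) (sym (val≡ t)))
Holds-cong val≡ (φ ∧ᶠ ψ)  =
  mk⇔ (λ (p , q) → to (Holds-cong val≡ φ) p , to (Holds-cong val≡ ψ) q)
      (λ (p , q) → from (Holds-cong val≡ φ) p , from (Holds-cong val≡ ψ) q)
  where open Equivalence
Holds-cong val≡ (φ ⇒ᶠ ψ)  =
  mk⇔ (λ p⇒q p → to (Holds-cong val≡ ψ) (p⇒q (from (Holds-cong val≡ φ) p)))
      (λ p⇒q p → from (Holds-cong val≡ ψ) (p⇒q (to (Holds-cong val≡ φ) p)))
  where open Equivalence

-- 0 stands for truth.
truthₑ : Formula → Expr
truthₑ (is0 t)   = t
truthₑ (is1 t)   = ifzₑ t then lit 1 else predₑ t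
truthₑ (isBit t) = predₑ t
truthₑ (φ ∧ᶠ ψ)  = ifzₑ truthₑ φ then truthₑ ψ else lit 1
truthₑ (φ ⇒ᶠ ψ)  = ifzₑ truthₑ φ then truthₑ ψ else lit 0

truthₑ-correct : ∀ φ w → ⟦ truthₑ φ ⟧ w ≡ 0 ⇔ Holds (λ t → ⟦ t ⟧ w) φ
truthₑ-correct (is0 t)   w = mk⇔ id id
truthₑ-correct (is1 t)   w with ⟦ t ⟧ w
... | zero  = mk⇔ (λ ()) (λ ())
... | suc n = mk⇔ (cong suc) suc-injective
truthₑ-correct (isBit t) w with ⟦ t ⟧ w
... | zero  = mk⇔ (λ _ → z≤n) (λ _ → refl)
... | suc n = mk⇔ (λ { refl → s≤s z≤n }) (λ { (s≤s n≤0) → n≤0⇒n≡0 n≤0 })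
truthₑ-correct (φ ∧ᶠ ψ)  w with ⟦ truthₑ φ ⟧ w | truthₑ-correct φ w
... | zero  | φ⇔ = mk⇔ (λ q → to φ⇔ refl , to (truthₑ-correct ψ w) q) (λ (_ , q) → from (truthₑ-correct ψ w) q)
  where open Equivalence
... | suc _ | φ⇔ = mk⇔ (λ ()) (λ (p , _) → case from φ⇔ p of λ ())
  where open Equivalence
truthₑ-correct (φ ⇒ᶠ ψ)  w with ⟦ truthₑ φ ⟧ w | truthₑ-correct φ w
... | zero  | φ⇔ = mk⇔ (λ q _ → to (truthₑ-correct ψ w) q) (λ p⇒q → from (truthₑ-correct ψ w) (p⇒q (to φ⇔ refl)))
  where open Equivalence
... | suc _ | φ⇔ = mk⇔ (λ _ p → case from φ⇔ p of λ ()) (λ _ → refl)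
  where open Equivalence

Monotone : (ℕ → Set) → Set
Monotone P = ∀ {m n} → m ≤ n → P m → P n

eventually-all : ∀ (Ps : List (ℕ → Set)) → All Monotone Ps → All (λ P → ∃ P) Ps → ∃ λ z → All (λ P → P z) Ps
eventually-all []       []             []             = 0 , []
eventually-all (P ∷ Ps) (mono ∷ monos) ((z , p) ∷ ps) with eventually-all Ps monos ps
... | z′ , ps′ = z + z′ , mono (m≤m+n z z′) p ∷ raise monos ps′
  where
  raise : ∀ {Qs} → All Monotone Qs → All (λ Q → Q z′) Qs → All (λ Q → Q (z + z′)) Qs
  raise []             []       = []
  raise (mono′ ∷ monos′) (q ∷ qs) = mono′ (m≤n+m z′ z) q ∷ raise monos′ qs

-- The CSC axioms for U_i = { x | Φ_m⟪i,x⟫ = 1 } and k(i,j,x) = Φ_n⟪i,⟪j,x⟫⟫, at i, j, x and a second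
-- point y; R e u v stands for Φ_e(u) = v.
record LocalCSC (R : ℕ → ℕ → ℕ → Set) (m n i j x y : ℕ) : Set where
  field
    m[i,x] m[j,x] k m[k,x] m[k,y] m[i,y] m[j,y] : ℕ
    m[i,x]↓  : R m ⟪ i , x ⟫ m[i,x]
    m[j,x]↓  : R m ⟪ j , x ⟫ m[j,x]
    k↓       : R n ⟪ i , ⟪ j , x ⟫ ⟫ k
    m[k,x]↓  : R m ⟪ k , x ⟫ m[k,x]
    m[k,y]↓  : R m ⟪ k , y ⟫ m[k,y]
    m[i,y]↓  : R m ⟪ i , y ⟫ m[i,y]
    m[j,y]↓  : R m ⟪ j , y ⟫ m[j,y]
    m[i,x]≤1 : m[i,x] ≤ 1
    basis    : m[i,x] ≡ 1 × m[j,x] ≡ 1 → m[k,x] ≡ 1 × (m[k,y] ≡ 1 → m[i,y] ≡ 1 × m[j,y] ≡ 1)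

LocalCSC-map : ∀ {R R′ : ℕ → ℕ → ℕ → Set} {m n i j x y} → (∀ {e u v} → R e u v → R′ e u v) →
               LocalCSC R m n i j x y → LocalCSC R′ m n i j x y
LocalCSC-map f L = record
  { m[i,x] = m[i,x] ; m[j,x] = m[j,x] ; k = k ; m[k,x] = m[k,x] ; m[k,y] = m[k,y] ; m[i,y] = m[i,y] ; m[j,y] = m[j,y]
  ; m[i,x]↓ = f m[i,x]↓ ; m[j,x]↓ = f m[j,x]↓ ; k↓ = f k↓ ; m[k,x]↓ = f m[k,x]↓
  ; m[k,y]↓ = f m[k,y]↓ ; m[i,y]↓ = f m[i,y]↓ ; m[j,y]↓ = f m[j,y]↓
  ; m[i,x]≤1 = m[i,x]≤1 ; basis = basis }
  where open LocalCSC L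

IsCSCPair : ℕ → ℕ → Set
IsCSCPair m n =
  Total m ×
  (∀ i x → Eval m ⟪ i , x ⟫ 0 ⊎ Eval m ⟪ i , x ⟫ 1) ×
  Total n ×
  (∀ i j x → Eval m ⟪ i , x ⟫ 1 → Eval m ⟪ j , x ⟫ 1 →
     ∀ k → Eval n ⟪ i , ⟪ j , x ⟫ ⟫ k →
       Eval m ⟪ k , x ⟫ 1 ×
       (∀ y → Eval m ⟪ k , y ⟫ 1 → Eval m ⟪ i , y ⟫ 1 × Eval m ⟪ j , y ⟫ 1))

IsCSCIndex⇔IsCSCPair : ∀ c → IsCSCIndex c ⇔ IsCSCPair (π₁ c) (π₂ c)
IsCSCIndex⇔IsCSCPair c = mk⇔ to (λ h → π₁ c , π₂ c , sym (⟪π₁,π₂⟫ c) , h)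
  where
  to : IsCSCIndex c → IsCSCPair (π₁ c) (π₂ c)
  to (m , n , refl , h) = subst₂ IsCSCPair (sym (π₁-⟪,⟫ m n)) (sym (π₂-⟪,⟫ m n)) h

≤1⇒0⊎1 : ∀ {v} → v ≤ 1 → v ≡ 0 ⊎ v ≡ 1
≤1⇒0⊎1 z≤n       = inj₁ refl
≤1⇒0⊎1 (s≤s z≤n) = inj₂ refl

IsCSCPair⇒LocalCSC : ∀ {m n} → IsCSCPair m n → ∀ i j x y → LocalCSC Eval m n i j x y
IsCSCPair⇒LocalCSC {m} {n} (totm , bit , totn , nbhd) i j x y = record
  { m[i,x] = Φm ⟪ i , x ⟫ ; m[j,x] = Φm ⟪ j , x ⟫ ; k = k ; m[k,x] = Φm ⟪ k , x ⟫ ; m[k,y] = Φm ⟪ k , y ⟫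
  ; m[i,y] = Φm ⟪ i , y ⟫ ; m[j,y] = Φm ⟪ j , y ⟫
  ; m[i,x]↓ = Φm↓ _ ; m[j,x]↓ = Φm↓ _ ; k↓ = proj₂ (totn ⟪ i , ⟪ j , x ⟫ ⟫) ; m[k,x]↓ = Φm↓ _
  ; m[k,y]↓ = Φm↓ _ ; m[i,y]↓ = Φm↓ _ ; m[j,y]↓ = Φm↓ _
  ; m[i,x]≤1 = bit≤1 (bit i x) ; basis = basis }
  where
  Φm : ℕ → ℕ
  Φm u = proj₁ (totm u)
  Φm↓ : ∀ u → Eval m u (Φm u)
  Φm↓ u = proj₂ (totm u)
  k = proj₁ (totn ⟪ i , ⟪ j , x ⟫ ⟫)
  Φm≡1 : ∀ {u} → Φm u ≡ 1 → Eval m u 1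
  Φm≡1 {u} eq = subst (Eval m u) eq (Φm↓ u)
  bit≤1 : Eval m ⟪ i , x ⟫ 0 ⊎ Eval m ⟪ i , x ⟫ 1 → Φm ⟪ i , x ⟫ ≤ 1
  bit≤1 (inj₁ d) rewrite Eval-deterministic (Φm↓ _) d = z≤n
  bit≤1 (inj₂ d) rewrite Eval-deterministic (Φm↓ _) d = s≤s z≤n
  basis : Φm ⟪ i , x ⟫ ≡ 1 × Φm ⟪ j , x ⟫ ≡ 1 →
          Φm ⟪ k , x ⟫ ≡ 1 × (Φm ⟪ k , y ⟫ ≡ 1 → Φm ⟪ i , y ⟫ ≡ 1 × Φm ⟪ j , y ⟫ ≡ 1)
  basis (ix , jx) with nbhd i j x (Φm≡1 ix) (Φm≡1 jx) k (proj₂ (totn _))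
  ... | kx , ky = Eval-deterministic (Φm↓ _) kx ,
                  λ ky≡1 → let iy , jy = ky y (Φm≡1 ky≡1) in
                           Eval-deterministic (Φm↓ _) iy , Eval-deterministic (Φm↓ _) jy

LocalCSC⇒IsCSCPair : ∀ {m n} → (∀ i j x y → LocalCSC Eval m n i j x y) → IsCSCPair m n
LocalCSC⇒IsCSCPair {m} {n} local = totm , bit , totn , nbhd
  where
  open LocalCSC
  totm : Total m
  totm u = m[i,x] L , subst (λ w → Eval m w (m[i,x] L)) (⟪π₁,π₂⟫ u) (m[i,x]↓ L)
    where L = local (π₁ u) 0 (π₂ u) 0
  bit : ∀ i x → Eval m ⟪ i , x ⟫ 0 ⊎ Eval m ⟪ i , x ⟫ 1
  bit i x with m[i,x] L | m[i,x]↓ L | ≤1⇒0⊎1 (m[i,x]≤1 L)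
    where L = local i 0 x 0
  ... | _ | d | inj₁ refl = inj₁ d
  ... | _ | d | inj₂ refl = inj₂ d
  totn : Total n
  totn u = k L , subst (λ w → Eval n w (k L)) (trans (cong ⟪ π₁ u ,_⟫ (⟪π₁,π₂⟫ (π₂ u))) (⟪π₁,π₂⟫ u)) (k↓ L)
    where L = local (π₁ u) (π₁ (π₂ u)) (π₂ (π₂ u)) 0
  nbhd : ∀ i j x → Eval m ⟪ i , x ⟫ 1 → Eval m ⟪ j , x ⟫ 1 → ∀ k′ → Eval n ⟪ i , ⟪ j , x ⟫ ⟫ k′ →
         Eval m ⟪ k′ , x ⟫ 1 × (∀ y → Eval m ⟪ k′ , y ⟫ 1 → Eval m ⟪ i , y ⟫ 1 × Eval m ⟪ j , y ⟫ 1)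
  nbhd i j x ix jx k′ k′↓ = kx , ky
    where
    module L y = LocalCSC (local i j x y)
    k≡ : ∀ y → L.k y ≡ k′
    k≡ y = Eval-deterministic (L.k↓ y) k′↓
    basis-at : ∀ y → L.m[k,x] y ≡ 1 × (L.m[k,y] y ≡ 1 → L.m[i,y] y ≡ 1 × L.m[j,y] y ≡ 1)
    basis-at y = L.basis y (Eval-deterministic (L.m[i,x]↓ y) ix , Eval-deterministic (L.m[j,x]↓ y) jx)
    kx : Eval m ⟪ k′ , x ⟫ 1
    kx = subst₂ (λ k v → Eval m ⟪ k , x ⟫ v) (k≡ 0) (proj₁ (basis-at 0)) (L.m[k,x]↓ 0)
    ky : ∀ y → Eval m ⟪ k′ , y ⟫ 1 → Eval m ⟪ i , y ⟫ 1 × Eval m ⟪ j , y ⟫ 1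
    ky y ky↓ with proj₂ (basis-at y)
                       (Eval-deterministic (subst (λ k → Eval m ⟪ k , y ⟫ (L.m[k,y] y)) (k≡ y) (L.m[k,y]↓ y)) ky↓)
    ... | iy , jy = subst (Eval m ⟪ i , y ⟫) iy (L.m[i,y]↓ y) , subst (Eval m ⟪ j , y ⟫) jy (L.m[j,y]↓ y)

LocalCSC-eventually : ∀ {m n i j x y} → LocalCSC (λ e u v → ∃ λ z → HaltsWithin z e u v) m n i j x y →
                      ∃ λ z → LocalCSC (HaltsWithin z) m n i j x y
LocalCSC-eventually {m} {n} {i} {j} {x} {y} L
  with eventually-all (H m ⟪ i , x ⟫ m[i,x] ∷ H m ⟪ j , x ⟫ m[j,x] ∷ H n ⟪ i , ⟪ j , x ⟫ ⟫ k ∷ H m ⟪ k , x ⟫ m[k,x] ∷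
                       H m ⟪ k , y ⟫ m[k,y] ∷ H m ⟪ i , y ⟫ m[i,y] ∷ H m ⟪ j , y ⟫ m[j,y] ∷ [])
                      (HaltsWithin-mono ∷ HaltsWithin-mono ∷ HaltsWithin-mono ∷ HaltsWithin-mono ∷
                       HaltsWithin-mono ∷ HaltsWithin-mono ∷ HaltsWithin-mono ∷ [])
                      (m[i,x]↓ ∷ m[j,x]↓ ∷ k↓ ∷ m[k,x]↓ ∷ m[k,y]↓ ∷ m[i,y]↓ ∷ m[j,y]↓ ∷ [])
  where
  open LocalCSC L
  H : ℕ → ℕ → ℕ → ℕ → Set
  H e u v z = HaltsWithin z e u v
... | z , ix ∷ jx ∷ k′ ∷ kx ∷ ky ∷ iy ∷ jy ∷ [] = z , record
  { m[i,x] = m[i,x] ; m[j,x] = m[j,x] ; k = k ; m[k,x] = m[k,x] ; m[k,y] = m[k,y] ; m[i,y] = m[i,y] ; m[j,y] = m[j,y]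
  ; m[i,x]↓ = ix ; m[j,x]↓ = jx ; k↓ = k′ ; m[k,x]↓ = kx ; m[k,y]↓ = ky ; m[i,y]↓ = iy ; m[j,y]↓ = jy
  ; m[i,x]≤1 = m[i,x]≤1 ; basis = basis }
  where open LocalCSC L

LocalCSC-Eval⇔HaltsWithin : ∀ {m n i j x y} → LocalCSC Eval m n i j x y ⇔ ∃ λ z → LocalCSC (HaltsWithin z) m n i j x y
LocalCSC-Eval⇔HaltsWithin =
  mk⇔ (λ L → LocalCSC-eventually (LocalCSC-map Eval⇒HaltsWithin L))
      (λ (z , L) → LocalCSC-map (HaltsWithin⇒Eval {z}) L)

haltsᶠ : Expr → Formula
haltsᶠ o = is1 (fstₑ o) ∧ᶠ is0 (sndₑ (sndₑ o))

valueₑ : Expr → Expr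
valueₑ o = fstₑ (sndₑ o)

-- A formula about the input ⟪ c , ⟪ ⟪ i , ⟪ j , ⟪ x , y ⟫ ⟫ ⟫ , z ⟫ ⟫, with c = ⟪ m , n ⟫ and z a step bound.
localCSCᶠ : Formula
localCSCᶠ =
  haltsᶠ o[i,x] ∧ᶠ haltsᶠ o[j,x] ∧ᶠ haltsᶠ oₖ ∧ᶠ haltsᶠ o[k,x] ∧ᶠ haltsᶠ o[k,y] ∧ᶠ haltsᶠ o[i,y] ∧ᶠ haltsᶠ o[j,y] ∧ᶠ
  isBit (valueₑ o[i,x]) ∧ᶠ
  (is1 (valueₑ o[i,x]) ∧ᶠ is1 (valueₑ o[j,x]) ⇒ᶠ
     is1 (valueₑ o[k,x]) ∧ᶠ (is1 (valueₑ o[k,y]) ⇒ᶠ is1 (valueₑ o[i,y]) ∧ᶠ is1 (valueₑ o[j,y])))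
  where
  c    = fstₑ var
  args = fstₑ (sndₑ var)
  z    = sndₑ (sndₑ var)
  i    = fstₑ args
  j    = fstₑ (sndₑ args)
  x    = fstₑ (sndₑ (sndₑ args))
  y    = sndₑ (sndₑ (sndₑ args))
  runₑ : Expr → Expr → Expr
  runₑ e u = app outcomeᶜ ⟨ e , ⟨ u , z ⟩ₑ ⟩ₑ
  oₖ     = runₑ (sndₑ c) ⟨ i , ⟨ j , x ⟩ₑ ⟩ₑ
  k      = valueₑ oₖ
  o[i,x] = runₑ (fstₑ c) ⟨ i , x ⟩ₑ
  o[j,x] = runₑ (fstₑ c) ⟨ j , x ⟩ₑ
  o[k,x] = runₑ (fstₑ c) ⟨ k , x ⟩ₑ
  o[k,y] = runₑ (fstₑ c) ⟨ k , y ⟩ₑ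
  o[i,y] = runₑ (fstₑ c) ⟨ i , y ⟩ₑ
  o[j,y] = runₑ (fstₑ c) ⟨ j , y ⟩ₑ

inputᵀ : ℕ → ℕ → ℕ → ℕ → ℕ → ℕ → Tree
inputᵀ c i j x y z = node (leaf c) (node (node (leaf i) (node (leaf j) (node (leaf x) (leaf y)))) (leaf z))

localCSCᶠ-correct : ∀ c i j x y z →
  Holds (λ t → ⌊ ⟦ t ⟧ᵀ (inputᵀ c i j x y z) ⌋) localCSCᶠ ⇔ LocalCSC (HaltsWithin z) (π₁ c) (π₂ c) i j x y
localCSCᶠ-correct c i j x y z = mk⇔ to from
  where
  m = π₁ c
  n = π₂ c
  to : Holds (λ t → ⌊ ⟦ t ⟧ᵀ (inputᵀ c i j x y z) ⌋) localCSCᶠ → LocalCSC (HaltsWithin z) m n i j x y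
  to ((a₁ , a₀) , (b₁ , b₀) , (k₁ , k₀) , (d₁ , d₀) , (e₁ , e₀) , (f₁ , f₀) , (g₁ , g₀) , bit , basis) = record
    { m[i,x] = _ ; m[j,x] = _ ; k = k ; m[k,x] = _ ; m[k,y] = _ ; m[i,y] = _ ; m[j,y] = _
    ; m[i,x]↓ = halted-outcome z m ⟪ i , x ⟫ a₁ a₀ ; m[j,x]↓ = halted-outcome z m ⟪ j , x ⟫ b₁ b₀
    ; k↓ = halted-outcome z n ⟪ i , ⟪ j , x ⟫ ⟫ k₁ k₀
    ; m[k,x]↓ = halted-outcome z m ⟪ k , x ⟫ d₁ d₀ ; m[k,y]↓ = halted-outcome z m ⟪ k , y ⟫ e₁ e₀
    ; m[i,y]↓ = halted-outcome z m ⟪ i , y ⟫ f₁ f₀ ; m[j,y]↓ = halted-outcome z m ⟪ j , y ⟫ g₁ g₀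
    ; m[i,x]≤1 = bit ; basis = basis }
    where k = π₁ (π₂ (outcome ⟪ n , ⟪ ⟪ i , ⟪ j , x ⟫ ⟫ , z ⟫ ⟫))
  from : LocalCSC (HaltsWithin z) m n i j x y → Holds (λ t → ⌊ ⟦ t ⟧ᵀ (inputᵀ c i j x y z) ⌋) localCSCᶠ
  from L with outcome-halted z n ⟪ i , ⟪ j , x ⟫ ⟫ (LocalCSC.k↓ L)
  ... | k₁ , k₀ , k≡ rewrite k≡
    with outcome-halted z m ⟪ i , x ⟫ m[i,x]↓ | outcome-halted z m ⟪ j , x ⟫ m[j,x]↓
       | outcome-halted z m ⟪ k , x ⟫ m[k,x]↓ | outcome-halted z m ⟪ k , y ⟫ m[k,y]↓
       | outcome-halted z m ⟪ i , y ⟫ m[i,y]↓ | outcome-halted z m ⟪ j , y ⟫ m[j,y]↓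
    where open LocalCSC L
  ... | a₁ , a₀ , a≡ | b₁ , b₀ , b≡ | d₁ , d₀ , d≡ | e₁ , e₀ , e≡ | f₁ , f₀ , f≡ | g₁ , g₀ , g≡
    rewrite a≡ | b≡ | d≡ | e≡ | f≡ | g≡ =
    (a₁ , a₀) , (b₁ , b₀) , (k₁ , k₀) , (d₁ , d₀) , (e₁ , e₀) , (f₁ , f₀) , (g₁ , g₀) , m[i,x]≤1 , basis
    where open LocalCSC L

Eval-code⇔ : ∀ {f} (cf : Computable f) x v → Eval (code cf) x v ⇔ f x ≡ v
Eval-code⇔ cf x v = mk⇔ (Eval-deterministic (evaluates cf x)) (λ { refl → evaluates cf x })

localCSCᶜ : Computable ⟦ truthₑ localCSCᶠ ⟧
localCSCᶜ = compile (truthₑ localCSCᶠ)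

HaltsWithin⇔localCSCᶜ : ∀ c i j x y z →
  LocalCSC (HaltsWithin z) (π₁ c) (π₂ c) i j x y ⇔ Eval (code localCSCᶜ) ⌊ inputᵀ c i j x y z ⌋ 0
HaltsWithin⇔localCSCᶜ c i j x y z =
  ⇔-sym (localCSCᶠ-correct c i j x y z ⇔-∘ (Holds-cong (λ t → sym (⌊⟦⟧ᵀ⌋ t V)) localCSCᶠ
         ⇔-∘ (truthₑ-correct localCSCᶠ ⌊ V ⌋ ⇔-∘ Eval-code⇔ localCSCᶜ ⌊ V ⌋ 0)))
  where V = inputᵀ c i j x y z

LocalCSC⇔localCSCᶜ : ∀ c i j x y →
  LocalCSC Eval (π₁ c) (π₂ c) i j x y ⇔ ∃ λ z → Eval (code localCSCᶜ) ⟪ c , ⟪ ⟪ i , ⟪ j , ⟪ x , y ⟫ ⟫ ⟫ , z ⟫ ⟫ 0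
LocalCSC⇔localCSCᶜ c i j x y =
  mk⇔ (λ L → let z , Lz = to LocalCSC-Eval⇔HaltsWithin L in z , to (HaltsWithin⇔localCSCᶜ c i j x y z) Lz)
      (λ (z , d) → from LocalCSC-Eval⇔HaltsWithin (z , from (HaltsWithin⇔localCSCᶜ c i j x y z) d))
  where open Equivalence

⟪π₁,π₂⟫³ : ∀ w → ⟪ π₁ w , ⟪ π₁ (π₂ w) , ⟪ π₁ (π₂ (π₂ w)) , π₂ (π₂ (π₂ w)) ⟫ ⟫ ⟫ ≡ w
⟪π₁,π₂⟫³ w = begin
  ⟪ π₁ w , ⟪ π₁ (π₂ w) , ⟪ π₁ (π₂ (π₂ w)) , π₂ (π₂ (π₂ w)) ⟫ ⟫ ⟫
    ≡⟨ cong (λ u → ⟪ π₁ w , ⟪ π₁ (π₂ w) , u ⟫ ⟫) (⟪π₁,π₂⟫ (π₂ (π₂ w))) ⟩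
  ⟪ π₁ w , ⟪ π₁ (π₂ w) , π₂ (π₂ w) ⟫ ⟫
    ≡⟨ cong (λ u → ⟪ π₁ w , u ⟫) (⟪π₁,π₂⟫ (π₂ w)) ⟩
  ⟪ π₁ w , π₂ w ⟫
    ≡⟨ ⟪π₁,π₂⟫ w ⟩
  w ∎
  where open ≡-Reasoning

IsCSCIndex-Π⁰₂ : IsΠ⁰₂ IsCSCIndex
IsCSCIndex-Π⁰₂ = code localCSCᶜ , (λ w → _ , evaluates localCSCᶜ w) , λ c → mk⇔ (index⇒ c) (⇒index c)
  where
  open Equivalence
  index⇒ : ∀ c → IsCSCIndex c → ∀ w → ∃ λ z → Eval (code localCSCᶜ) ⟪ c , ⟪ w , z ⟫ ⟫ 0
  index⇒ c I w = z , subst (λ u → Eval (code localCSCᶜ) ⟪ c , ⟪ u , z ⟫ ⟫ 0) (⟪π₁,π₂⟫³ w) d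
    where
    L = IsCSCPair⇒LocalCSC (to (IsCSCIndex⇔IsCSCPair c) I) (π₁ w) (π₁ (π₂ w)) (π₁ (π₂ (π₂ w))) (π₂ (π₂ (π₂ w)))
    z = proj₁ (to (LocalCSC⇔localCSCᶜ c _ _ _ _) L)
    d = proj₂ (to (LocalCSC⇔localCSCᶜ c _ _ _ _) L)
  ⇒index : ∀ c → (∀ w → ∃ λ z → Eval (code localCSCᶜ) ⟪ c , ⟪ w , z ⟫ ⟫ 0) → IsCSCIndex c
  ⇒index c h = from (IsCSCIndex⇔IsCSCPair c)
    (LocalCSC⇒IsCSCPair (λ i j x y → from (LocalCSC⇔localCSCᶜ c i j x y) (h ⟪ i , ⟪ j , ⟪ x , y ⟫ ⟫ ⟫)))

-- Every Π⁰₂ set reduces to the CSC indices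

same-instr : ∀ {i} j → ⌜ i ⌝ ≡ tag j + 8 * payload j → i ≡ j
same-instr j eq = ⌜⌝-injective (trans eq (sym (⌜⌝-def j)))

Eval-comp⁻¹ : ∀ {a b u v} → Eval ⌜ compᴵ a b ⌝ u v → ∃ λ z → Eval b u z × Eval a z v
Eval-comp⁻¹ (ev-comp {a = a} {b} {z = z} eq d₁ d₂) with same-instr (compᴵ a b) eq
... | refl = z , d₁ , d₂
Eval-comp⁻¹ (ev-zero {k = k} eq)            = contradiction (same-instr (zeroᴵ k) eq) λ ()
Eval-comp⁻¹ (ev-succ {k = k} eq)            = contradiction (same-instr (succᴵ k) eq) λ ()
Eval-comp⁻¹ (ev-fst {k = k} eq _)           = contradiction (same-instr (fstᴵ k) eq) λ ()
Eval-comp⁻¹ (ev-snd {k = k} eq _)           = contradiction (same-instr (sndᴵ k) eq) λ ()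
Eval-comp⁻¹ (ev-pair {a = a} {b} eq _ _)    = contradiction (same-instr (pairᴵ a b) eq) λ ()
Eval-comp⁻¹ (ev-rec0 {a = a} {b} eq _)      = contradiction (same-instr (recᴵ a b) eq) λ ()
Eval-comp⁻¹ (ev-recS {a = a} {b} eq _ _)    = contradiction (same-instr (recᴵ a b) eq) λ ()
Eval-comp⁻¹ (ev-mu {a = a} eq _ _)          = contradiction (same-instr (muᴵ a) eq) λ ()

Eval-mu⁻¹ : ∀ {a u v} → Eval ⌜ muᴵ a ⌝ u v → Eval a ⟪ u , v ⟫ 0
Eval-mu⁻¹ (ev-mu {a = a} eq d _) with same-instr (muᴵ a) eq
... | refl = d
Eval-mu⁻¹ (ev-zero {k = k} eq)              = contradiction (same-instr (zeroᴵ k) eq) λ ()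
Eval-mu⁻¹ (ev-succ {k = k} eq)              = contradiction (same-instr (succᴵ k) eq) λ ()
Eval-mu⁻¹ (ev-fst {k = k} eq _)             = contradiction (same-instr (fstᴵ k) eq) λ ()
Eval-mu⁻¹ (ev-snd {k = k} eq _)             = contradiction (same-instr (sndᴵ k) eq) λ ()
Eval-mu⁻¹ (ev-comp {a = a} {b} eq _ _)      = contradiction (same-instr (compᴵ a b) eq) λ ()
Eval-mu⁻¹ (ev-pair {a = a} {b} eq _ _)      = contradiction (same-instr (pairᴵ a b) eq) λ ()
Eval-mu⁻¹ (ev-rec0 {a = a} {b} eq _)        = contradiction (same-instr (recᴵ a b) eq) λ ()
Eval-mu⁻¹ (ev-recS {a = a} {b} eq _ _)      = contradiction (same-instr (recᴵ a b) eq) λ ()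

taggedᶜ : ∀ t → Computable (λ u → t + 8 * u)
taggedᶜ t = computable-≗ fold≡tagged (foldᶜ plus8ᶜ ∘ᶜ ⟨ constᶜ t , idᶜ ⟩ᶜ)
  where
  plus8ᶜ : Computable (8 +_)
  plus8ᶜ = compile (sucₑ (sucₑ (sucₑ (sucₑ (sucₑ (sucₑ (sucₑ (sucₑ var))))))))
  fold≡tagged : ∀ u → fold (π₁ ⟪ t , u ⟫) (8 +_) (π₂ ⟪ t , u ⟫) ≡ t + 8 * u
  fold≡tagged u rewrite π₁-⟪,⟫ t u | π₂-⟪,⟫ t u | *+-is-fold u 8 {t} =
    trans (+-comm (u * 8) t) (cong (t +_) (*-comm u 8))

constCodeᶜ : Computable constCode
constCodeᶜ =
  computable-≗ fold≡constCode (foldᶜ (taggedᶜ 4 ∘ᶜ ⟨ constᶜ ⌜ succᴵ 0 ⌝ , idᶜ ⟩ᶜ) ∘ᶜ ⟨ constᶜ ⌜ zeroᴵ 0 ⌝ , idᶜ ⟩ᶜ)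
  where
  push : ℕ → ℕ
  push u = 4 + 8 * ⟪ ⌜ succᴵ 0 ⌝ , u ⟫
  go : ∀ n → fold ⌜ zeroᴵ 0 ⌝ push n ≡ constCode n
  go zero    = refl
  go (suc n) = trans (cong push (go n)) (sym (⌜⌝-def (compᴵ ⌜ succᴵ 0 ⌝ (constCode n))))
  fold≡constCode : ∀ n → fold (π₁ ⟪ ⌜ zeroᴵ 0 ⌝ , n ⟫) push (π₂ ⟪ ⌜ zeroᴵ 0 ⌝ , n ⟫) ≡ constCode n
  fold≡constCode n rewrite π₁-⟪,⟫ ⌜ zeroᴵ 0 ⌝ n | π₂-⟪,⟫ ⌜ zeroᴵ 0 ⌝ n = go n

smn : ℕ → ℕ → ℕ
smn a x = ⌜ compᴵ a ⌜ pairᴵ (constCode x) (code idᶜ) ⌝ ⌝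

Eval-⟨const,id⟩ : ∀ x u → Eval ⌜ pairᴵ (constCode x) (code idᶜ) ⌝ u ⟪ x , u ⟫
Eval-⟨const,id⟩ x u = ev-pair (⌜⌝-def (pairᴵ _ _)) (Eval-constCode x u) (evaluates idᶜ u)

Eval-smn : ∀ {a} x {u v} → Eval a ⟪ x , u ⟫ v → Eval (smn a x) u v
Eval-smn x {u} d = ev-comp (⌜⌝-def (compᴵ _ _)) (Eval-⟨const,id⟩ x u) d

Eval-smn⁻¹ : ∀ {a} x {u v} → Eval (smn a x) u v → Eval a ⟪ x , u ⟫ v
Eval-smn⁻¹ {a} x {u} {v} d with Eval-comp⁻¹ d
... | z , d₁ , d₂ = subst (λ w → Eval a w v) (Eval-deterministic d₁ (Eval-⟨const,id⟩ x u)) d₂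

smnᶜ : ∀ a → Computable (smn a)
smnᶜ a = computable-≗ (λ x → sym (code≡ x))
                      (taggedᶜ 4 ∘ᶜ ⟨ constᶜ a , taggedᶜ 5 ∘ᶜ ⟨ constCodeᶜ , constᶜ (code idᶜ) ⟩ᶜ ⟩ᶜ)
  where
  code≡ : ∀ x → smn a x ≡ 4 + 8 * ⟪ a , 5 + 8 * ⟪ constCode x , code idᶜ ⟫ ⟫
  code≡ x = trans (⌜⌝-def (compᴵ _ _)) (cong (λ p → 4 + 8 * ⟪ a , p ⟫) (⌜⌝-def (pairᴵ _ _)))

least-zero : ∀ (g : ℕ → ℕ) {z} → g z ≡ 0 → ∃ λ N → g N ≡ 0 × (∀ m → m < N → ∃ λ v → g m ≡ suc v)
least-zero g {z} gz≡0 = search z 0 (λ _ ()) gz≡0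
  where
  search : ∀ d s → (∀ m → m < s → ∃ λ v → g m ≡ suc v) → g (s + d) ≡ 0 →
           ∃ λ N → g N ≡ 0 × (∀ m → m < N → ∃ λ v → g m ≡ suc v)
  search zero    s below g≡0 = s , subst (λ n → g n ≡ 0) (+-identityʳ s) g≡0 , below
  search (suc d) s below g≡0 with g s in gs≡
  ... | zero  = s , gs≡ , below
  ... | suc v = search d (suc s) below′ (subst (λ n → g n ≡ 0) (+-suc s d) g≡0)
    where
    below′ : ∀ m → m < suc s → ∃ λ v → g m ≡ suc v
    below′ m m<1+s with m<1+n⇒m<n∨m≡n m<1+s
    ... | inj₁ m<s  = below m m<s
    ... | inj₂ refl = v , gs≡

module Reduction (eQ : ℕ) (totQ : Total eQ) where

  codeᴹ : ℕ → ℕ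
  codeᴹ x = ⌜ compᴵ (constCode 1) ⌜ muᴵ (smn eQ x) ⌝ ⌝

  Eval-codeᴹ : ∀ x {u} → (∃ λ z → Eval eQ ⟪ x , ⟪ u , z ⟫ ⟫ 0) → Eval (codeᴹ x) u 1
  Eval-codeᴹ x {u} (z , d) =
    ev-comp (⌜⌝-def (compᴵ _ _)) (ev-mu (⌜⌝-def (muᴵ _)) Φ⟪u,N⟫≡0 positive) (Eval-constCode 1 N)
    where
    g : ℕ → ℕ
    g m = proj₁ (totQ ⟪ x , ⟪ u , m ⟫ ⟫)
    Q↓ : ∀ m → Eval eQ ⟪ x , ⟪ u , m ⟫ ⟫ (g m)
    Q↓ m = proj₂ (totQ ⟪ x , ⟪ u , m ⟫ ⟫)
    least = least-zero g (Eval-deterministic (Q↓ z) d)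
    N = proj₁ least
    Φ⟪u,N⟫≡0 : Eval (smn eQ x) ⟪ u , N ⟫ 0
    Φ⟪u,N⟫≡0 = Eval-smn x (subst (Eval eQ _) (proj₁ (proj₂ least)) (Q↓ N))
    positive : PositiveBelow (smn eQ x) u N
    positive m m<N = let v , gm≡1+v = proj₂ (proj₂ least) m m<N in v , Eval-smn x (subst (Eval eQ _) gm≡1+v (Q↓ m))

  Eval-codeᴹ⁻¹ : ∀ x {u v} → Eval (codeᴹ x) u v → ∃ λ z → Eval eQ ⟪ x , ⟪ u , z ⟫ ⟫ 0
  Eval-codeᴹ⁻¹ x d with Eval-comp⁻¹ d
  ... | z , d-mu , _ = z , Eval-smn⁻¹ x (Eval-mu⁻¹ d-mu)

  IsCSCIndex⇔Q : ∀ x → IsCSCIndex ⟪ codeᴹ x , ⌜ zeroᴵ 0 ⌝ ⟫ ⇔ (∀ u → ∃ λ z → Eval eQ ⟪ x , ⟪ u , z ⟫ ⟫ 0)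
  IsCSCIndex⇔Q x = mk⇔ to from
    where
    to : IsCSCIndex ⟪ codeᴹ x , ⌜ zeroᴵ 0 ⌝ ⟫ → ∀ u → ∃ λ z → Eval eQ ⟪ x , ⟪ u , z ⟫ ⟫ 0
    to (m , n , c≡ , totm , _) u =
      Eval-codeᴹ⁻¹ x (subst (λ e → Eval e u _) (sym (⟪,⟫-injectiveˡ c≡)) (proj₂ (totm u)))
    from : (∀ u → ∃ λ z → Eval eQ ⟪ x , ⟪ u , z ⟫ ⟫ 0) → IsCSCIndex ⟪ codeᴹ x , ⌜ zeroᴵ 0 ⌝ ⟫
    from h = codeᴹ x , ⌜ zeroᴵ 0 ⌝ , refl , (λ u → 1 , all u) , (λ _ _ → inj₂ (all _)) ,
             (λ u → 0 , evaluates zeroᶜ u) , (λ _ _ _ _ _ _ _ → all _ , λ _ _ → all _ , all _)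
      where
      all : ∀ u → Eval (codeᴹ x) u 1
      all u = Eval-codeᴹ x (h u)

  reductionᶜ : Computable (λ x → ⟪ codeᴹ x , ⌜ zeroᴵ 0 ⌝ ⟫)
  reductionᶜ = computable-≗ (λ x → cong ⟪_, ⌜ zeroᴵ 0 ⌝ ⟫ (sym (codeᴹ≡ x)))
    ⟨ taggedᶜ 4 ∘ᶜ ⟨ constᶜ (constCode 1) , taggedᶜ 7 ∘ᶜ smnᶜ eQ ⟩ᶜ , constᶜ ⌜ zeroᴵ 0 ⌝ ⟩ᶜ
    where
    codeᴹ≡ : ∀ x → codeᴹ x ≡ 4 + 8 * ⟪ constCode 1 , 7 + 8 * smn eQ x ⟫
    codeᴹ≡ x = trans (⌜⌝-def (compᴵ _ _)) (cong (λ p → 4 + 8 * ⟪ constCode 1 , p ⟫) (⌜⌝-def (muᴵ _)))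

IsCSCIndex-Π⁰₂-hard : ∀ Q → IsΠ⁰₂ Q → Q ≤ₘ IsCSCIndex
IsCSCIndex-Π⁰₂-hard Q (eQ , totQ , Q⇔) = code reductionᶜ , (λ x → _ , evaluates reductionᶜ x) , reduces
  where
  open Reduction eQ totQ
  reduces : ∀ x y → Eval (code reductionᶜ) x y → Q x ⇔ IsCSCIndex y
  reduces x y d = subst (λ y → Q x ⇔ IsCSCIndex y) (Eval-deterministic (evaluates reductionᶜ x) d)
                        (⇔-sym (IsCSCIndex⇔Q x) ⇔-∘ Q⇔ x)

mainTheorem9 : IsΠ⁰₂-complete IsCSCIndex
mainTheorem9 = IsCSCIndex-Π⁰₂ , IsCSCIndex-Π⁰₂-hard
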